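{- Let $M$ be an oriented $3$-valent map, and define $H_1(M)=\ker\big(Rubik(M)_{corner,\,side\,edge}\to Rubik(M)_{corner,\,edge}\big)$, $H_2(M)=\ker\big(Rubik(M)_{corner,\,edge}\to Rubik(M)_{corner}\big)$, $H_3(M)=\ker\big(Rubik(M)_{corner}\to Rubik(M)_{vertex}\big)$, where the maps are the restriction homomorphisms. Then: (i) $H_1(M)$ is isomorphic to a subgroup of $\mathbb{Z}_2^{|E(M)|-1}$; (ii) $H_2(M)$ is isomorphic to a subgroup of the alternating group $A_{|E(M)|}$ (via its action on $E(M)$); (iii) $H_3(M)$ is isomorphic to a subgroup of $\mathbb{Z}_3^{|V(M)|-1}$; (iv) $Rubik(M)_{vertex}$ is a subgroup of $A_{|V(M)|}$ if all faces of $M$ have odd size, and a subgroup of $S_{|V(M)|}$ otherwise.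
   Context: A $3$-valent map $M$ is a cellularly embedded $3$-regular graph on a surface; $V(M)$, $E(M)$, $Face(M)$ denote its vertices, edges and faces; the size of a face is the number of its edges. Throughout, every face boundary is a simple cycle, every edge lies in two distinct faces, and the three faces at any vertex are pairwise distinct. A corner is a pair $(F,v)$ with $v$ a vertex of face $F$; a side edge is a pair $(F,e)$ with $e$ an edge of face $F$. Side movement: let $F$ have boundary cycle $v_1,\dots,v_p$ (indices mod $p$, in a chosen direction), edges $e_i=v_iv_{i+1}$, and let $G_i$ be the face other than $F$ containing $e_i$. The side movement $sm(M,F)$ is the permutation of corners and side edges given by $(F,v_i)\mapsto(F,v_{i+1})$, $(G_{i-1},v_i)\mapsto(G_i,v_{i+1})$, $(G_i,v_i)\mapsto(G_{i+1},v_{i+1})$, $(F,e_i)\mapsto(F,e_{i+1})$, $(G_i,e_i)\mapsto(G_{i+1},e_{i+1})$, fixing everything else. $Rubik(M)$ is the group of permutations of corners and side edges generated by all $sm(M,F)$; this is $Rubik(M)_{corner,\,side\,edge}$. For a set $X$ of objects on which $Rubik(M)$ acts (corners, edges, vertices, or disjoint unions), $Rubik(M)_X$ denotes the permutation group on $X$ induced by $Rubik(M)$, the action on edges being induced from side edges $(F,e)\mapsto e$ and on vertices from corners $(F,v)\mapsto v$. -}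

module Defs where

open import Data.Nat as ℕ using (ℕ; zero; suc; _≤_; _%_; _<ᵇ_; _+_; _*_; _∸_)
open import Data.Nat.Properties using (_<?_)
open import Data.Fin as Fin using (Fin; zero; suc; toℕ; fromℕ; fromℕ<; inject₁)
open import Data.Fin.Properties using (any?)
open import Data.Bool using (Bool; true; false; if_then_else_; _∧_; not; _xor_)
import Data.Bool
open import Data.List using (List; map; allFin)
open import Data.Nat.ListAction using (sum)
open import Data.Product using (Σ; ∃; _×_; _,_; proj₁; proj₂)
open import Data.Sum using (_⊎_)
open import Data.Maybe using (Maybe; just; nothing; is-just)
open import Relation.Nullary using (¬_; yes; no)
open import Relation.Nullary.Decidable using (isYes)
open import Relation.Binary.PropositionalEquality using (_≡_; _≢_)
open import Function using (_∘_; id)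

csuc : ∀ {n} → Fin n → Fin n
csuc {suc n} i with suc (toℕ i) <? suc n
... | yes p = fromℕ< p
... | no _  = zero

cpred : ∀ {n} → Fin n → Fin n
cpred {suc n} zero    = fromℕ n
cpred {suc n} (suc i) = inject₁ i

-- The group Z_3 (Fin 3 with addition mod 3).  Z_2 is Bool with _xor_.

_+₃_ : Fin 3 → Fin 3 → Fin 3
zero +₃ b = b
suc zero +₃ zero = suc zero
suc zero +₃ suc zero = suc (suc zero)
suc zero +₃ suc (suc zero) = zero
suc (suc zero) +₃ zero = suc (suc zero)
suc (suc zero) +₃ suc zero = zero
suc (suc zero) +₃ suc (suc zero) = suc zero

IsPerm : ∀ {n} → (Fin n → Fin n) → Set
IsPerm π = ∀ i j → π i ≡ π j → i ≡ j   -- injective, hence bijective (finite)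

inversions : ∀ {n} → (Fin n → Fin n) → ℕ
inversions {n} π =
  sum (map (λ i → sum (map (λ j →
    if (toℕ i <ᵇ toℕ j) ∧ (toℕ (π j) <ᵇ toℕ (π i)) then 1 else 0)
    (allFin n))) (allFin n))

IsEvenPerm : ∀ {n} → (Fin n → Fin n) → Set
IsEvenPerm π = IsPerm π × (inversions π % 2 ≡ 0)

-- 3-valent maps, combinatorially: a graph (vertices, edges with ends)
-- together with the faces, each given by its boundary cycle
-- v_0, …, v_{p-1} and edges e_i = v_i v_{i+1} (indices mod p), listed in
-- the direction given by the orientation.

record Map3 : Set where
  field
    nV nE nF : ℕ
    ends : Fin nE → Fin nV × Fin nV
    size : Fin nF → ℕ
    vtx  : (F : Fin nF) → Fin (size F) → Fin nV
    edg  : (F : Fin nF) → Fin (size F) → Fin nE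

module _ (M : Map3) where
  open Map3 M

  -- degree of a vertex (a loop counts twice)
  degree : Fin nV → ℕ
  degree v = sum (map (λ e → c (proj₁ (ends e)) + c (proj₂ (ends e))) (allFin nE))
    where
    c : Fin nV → ℕ
    c a = if isYes (a Fin.≟ v) then 1 else 0

  data Reach : Fin nV → Fin nV → Set where
    here : ∀ {v} → Reach v v
    step : ∀ {u v} (e : Fin nE) → (ends e ≡ (u , v) ⊎ ends e ≡ (v , u)) →
           ∀ {w} → Reach v w → Reach u w

  OnFace : Fin nF → Fin nV → Set
  OnFace F v = ∃ λ i → vtx F i ≡ v

  record IsOriented3ValentMap : Set where
    field
      size-pos  : ∀ F → 1 ≤ size F
      vtx-inj   : ∀ F i j → vtx F i ≡ vtx F j → i ≡ j
      edg-inj   : ∀ F i j → edg F i ≡ edg F j → i ≡ j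
      edg-ends  : ∀ F i → ends (edg F i) ≡ (vtx F i , vtx F (csuc i))
                        ⊎ ends (edg F i) ≡ (vtx F (csuc i) , vtx F i)
      cubic     : ∀ v → degree v ≡ 3
      connected : ∀ u v → Reach u v
      edge-faces : ∀ e → Σ (Fin nF) λ F → Σ (Fin nF) λ G → F ≢ G ×
                     (∃ λ i → edg F i ≡ e) × (∃ λ j → edg G j ≡ e) ×
                     (∀ H k → edg H k ≡ e → H ≡ F ⊎ H ≡ G)
      vertex-faces : ∀ v → Σ (Fin nF) λ F₁ → Σ (Fin nF) λ F₂ → Σ (Fin nF) λ F₃ →
                     F₁ ≢ F₂ × F₁ ≢ F₃ × F₂ ≢ F₃ ×
                     OnFace F₁ v × OnFace F₂ v × OnFace F₃ v ×
                     (∀ H → OnFace H v → H ≡ F₁ ⊎ H ≡ F₂ ⊎ H ≡ F₃)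
      -- orientation: the two faces at an edge traverse it in opposite directions
      oriented : ∀ F i G j → F ≢ G → edg F i ≡ edg G j →
                 vtx F i ≡ vtx G (csuc j) × vtx F (csuc i) ≡ vtx G j

  -- Permutations act on all of
  -- Fin nF × Fin nV resp. Fin nF × Fin nE; pairs that are not corners /
  -- side edges are fixed by every side movement and are ignored in all
  -- comparisons below.

  Cor : Set
  Cor = Fin nF × Fin nV

  Side : Set
  Side = Fin nF × Fin nE

  posV : (F : Fin nF) → Fin nV → Maybe (Fin (size F))
  posV F w with any? (λ i → vtx F i Fin.≟ w)
  ... | yes (i , _) = just i
  ... | no _        = nothing

  posE : (F : Fin nF) → Fin nE → Maybe (Fin (size F))
  posE F e with any? (λ i → edg F i Fin.≟ e)
  ... | yes (i , _) = just i
  ... | no _        = nothing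

  otherFace : Fin nF → Fin nE → Fin nF
  otherFace F e with any? (λ H → (not (isYes (H Fin.≟ F)) ∧ is-just (posE H e)) Data.Bool.≟ true)
  ... | yes (H , _) = H
  ... | no _        = F

  module _ (F : Fin nF) where
    v : Fin (size F) → Fin nV
    v = vtx F
    e : Fin (size F) → Fin nE
    e = edg F
    G : Fin (size F) → Fin nF
    G i = otherFace F (e i)

    smCor : Cor → Cor
    smCor (H , w) with posV F w
    ... | nothing = (H , w)
    ... | just i with H Fin.≟ F
    ...   | yes _ = (F , v (csuc i))
    ...   | no _ with H Fin.≟ G (cpred i)
    ...     | yes _ = (G i , v (csuc i))
    ...     | no _ with H Fin.≟ G i
    ...       | yes _ = (G (csuc i) , v (csuc i))
    ...       | no _  = (H , w)

    smSide : Side → Side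
    smSide (H , x) with posE F x
    ... | nothing = (H , x)
    ... | just i with H Fin.≟ F
    ...   | yes _ = (F , e (csuc i))
    ...   | no _ with H Fin.≟ G i
    ...     | yes _ = (G (csuc i) , e (csuc i))
    ...     | no _  = (H , x)

  -- A permutation of corners ⊎ side edges preserving both parts,
  -- represented by its two components.
  Elt : Set
  Elt = (Cor → Cor) × (Side → Side)

  sm : Fin nF → Elt
  sm F = smCor F , smSide F

  _·_ : Elt → Elt → Elt
  (a , b) · (c , d) = (a ∘ c , b ∘ d)

  idElt : Elt
  idElt = (id , id)

  -- Rubik(M): the group generated by the side movements
  -- (for permutations of a finite set, the generated monoid is the generated group)
  data InRubik : Elt → Set where
    rid  : InRubik idElt
    rstep : ∀ F {g} → InRubik g → InRubik (sm F · g)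

  _≈_ : Elt → Elt → Set
  g ≈ h = (∀ F i → proj₁ g (F , vtx F i) ≡ proj₁ h (F , vtx F i)) ×
          (∀ F i → proj₂ g (F , edg F i) ≡ proj₂ h (F , edg F i))

  _≈C_ : Elt → Elt → Set
  g ≈C h = ∀ F i → proj₁ g (F , vtx F i) ≡ proj₁ h (F , vtx F i)

  FixCorners : Elt → Set
  FixCorners g = ∀ F i → proj₁ g (F , vtx F i) ≡ (F , vtx F i)

  FixEdges : Elt → Set
  FixEdges g = ∀ F i → proj₂ (proj₂ g (F , edg F i)) ≡ edg F i

  FixVertices : Elt → Set
  FixVertices g = ∀ F i → proj₂ (proj₁ g (F , vtx F i)) ≡ vtx F i

  EdgeAction : Elt → (Fin nE → Fin nE) → Set
  EdgeAction g π = ∀ F i → proj₂ (proj₂ g (F , edg F i)) ≡ π (edg F i)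

  VertexAction : Elt → (Fin nV → Fin nV) → Set
  VertexAction g π = ∀ F i → proj₂ (proj₁ g (F , vtx F i)) ≡ π (vtx F i)

  InH₁ : Elt → Set
  InH₁ g = InRubik g × FixCorners g × FixEdges g

  -- H₃(M) = ker(Rubik_{corner} → Rubik_{vertex}), elements represented by
  -- any g ∈ Rubik(M) inducing them (compared with _≈C_)
  InH₃ : Elt → Set
  InH₃ g = InRubik g × FixVertices g

  Part-i : Set
  Part-i = Σ (Elt → Fin (nE ∸ 1) → Bool) λ φ →
    (∀ g h → InH₁ g → InH₁ h → g ≈ h → ∀ k → φ g k ≡ φ h k) ×
    (∀ g h → InH₁ g → InH₁ h → ∀ k → φ (g · h) k ≡ (φ g k xor φ h k)) ×
    (∀ g h → InH₁ g → InH₁ h → (∀ k → φ g k ≡ φ h k) → g ≈ h)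

  -- (ii) H₂ = ker(Rubik_{corner,edge} → Rubik_{corner}) acts on E(M) by even
  -- permutations; its elements are the actions on corners ⊎ edges of those
  -- g ∈ Rubik(M) fixing all corners, hence are determined by the edge action.
  Part-ii : Set
  Part-ii = ∀ g → InRubik g → FixCorners g →
    Σ (Fin nE → Fin nE) λ π → IsEvenPerm π × EdgeAction g π

  Part-iii : Set
  Part-iii = Σ (Elt → Fin (nV ∸ 1) → Fin 3) λ φ →
    (∀ g h → InH₃ g → InH₃ h → g ≈C h → ∀ k → φ g k ≡ φ h k) ×
    (∀ g h → InH₃ g → InH₃ h → ∀ k → φ (g · h) k ≡ (φ g k +₃ φ h k)) ×
    (∀ g h → InH₃ g → InH₃ h → (∀ k → φ g k ≡ φ h k) → g ≈C h)

  Part-iv : Set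
  Part-iv = ∀ g → InRubik g →
    Σ (Fin nV → Fin nV) λ π → IsPerm π × VertexAction g π ×
      ((∀ F → size F % 2 ≡ 1) → IsEvenPerm π)

-- Every element of Rubik(M) is a legal move: it sends corners to corners and sides to
-- sides, commutes with turning around a vertex and with crossing an edge to its other
-- side, and permutes V(M) and E(M) with equal parity. Record where a move sends the
-- reference corner at each vertex as a twist in Z₃ (the position of the image face in the
-- cyclic order of the faces at that vertex) and where it sends the reference side of each
-- edge as a flip in Z₂. A side movement along a p-gon is a p-cycle on the vertices and on
-- the edges of the face, and its twists and flips telescope around the face to 0; all of
-- this survives composition. On H₁ and H₃ a move is determined by its flips, resp.
-- twists, which add up under composition, and their vanishing total pins down the last
-- coordinate. H₂ permutes E(M) with the parity of its trivial vertex permutation, and a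
-- p-cycle is even when p is odd.
module Submission where

open import Data.Nat using (ℕ; zero; suc; _+_; _*_; _∸_; _%_; _<_; _<ᵇ_; s≤s; s≤s⁻¹; z≤n; NonZero)
open import Data.Nat.Properties
  using (+-*-semiring; +-assoc; +-comm; +-suc; +-identityʳ; *-comm; *-cancelˡ-≡; 0≢1+n; suc-injective; ≤∧≮⇒≡; <-irrefl; <⇒≢)
  renaming (_<?_ to _<ℕ?_)
open import Data.Nat.DivMod using (%-distribˡ-+; [m+n]%n≡m%n; [m+kn]%n≡m%n; m<n⇒m%n≡m; m%n<n)
open import Data.Nat.ListAction using () renaming (sum to listSum)
open import Data.List using (map; allFin; tabulate)
open import Data.List.Properties using (map-tabulate)
open import Data.Fin as Fin using (Fin; zero; suc; toℕ; fromℕ; inject₁)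
open import Data.Fin.Properties
  using (toℕ-injective; toℕ-fromℕ<; toℕ-fromℕ; toℕ-inject₁; toℕ<n; any?; pigeonhole)
  renaming (suc-injective to Fin-suc-injective)
open import Data.Fin.Permutation
  using (Permutation′; permutation; _⟨$⟩ʳ_; _∘ₚ_; transpose)
  renaming (id to idₚ; _≈_ to _≈ₚ_)
open import Data.Bool using (Bool; true; false; if_then_else_; not; _∧_; _xor_)
import Data.Bool
open import Data.Bool.Properties using (xor-annihilates-not; xor-comm)
open import Data.Maybe using (just; nothing; is-just)
open import Data.Product using (Σ; ∃; ∃₂; _×_; _,_; proj₁; proj₂)
open import Data.Sum using (_⊎_; inj₁; inj₂)
open import Data.Empty using (⊥; ⊥-elim)
open import Relation.Nullary using (yes; no; does)
open import Relation.Nullary.Decidable using (isYes; dec-true; dec-false; toSum)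
open import Relation.Binary.PropositionalEquality
open import Function using (_∘_; id; Injective; Injection)
open import Function.Properties.Inverse using (Inverse⇒Injection)
open import Algebra.Properties.Semiring.Sum +-*-semiring
  using (sum; sum-syntax; sum-cong-≗; sum-replicate-zero; sum-init-last; ∑-distrib-+; ∑-comm; ∑-permute; *-distribˡ-sum)

open import Defs hiding (v; e)

module FiniteSum where

  listSum-allFin : ∀ n (f : Fin n → ℕ) → listSum (map f (allFin n)) ≡ ∑[ i < n ] f i
  listSum-allFin n f = trans (cong listSum (map-tabulate id f)) (go n f)
    where
    go : ∀ n (f : Fin n → ℕ) → listSum (tabulate f) ≡ sum f
    go zero f = refl
    go (suc n) f = cong (f zero +_) (go n (f ∘ suc))

  ∑-zero : ∀ n {f : Fin n → ℕ} → (∀ i → f i ≡ 0) → ∑[ i < n ] f i ≡ 0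
  ∑-zero n f≡0 = trans (sum-cong-≗ f≡0) (sum-replicate-zero n)

  ∑-2* : ∀ n (f : Fin n → ℕ) → ∑[ i < n ] (2 * f i) ≡ 2 * (∑[ i < n ] f i)
  ∑-2* n f = sym (*-distribˡ-sum 2 f)

  ∑-%-cong : ∀ n m .{{_ : NonZero m}} {f g : Fin n → ℕ} →
             (∀ i → f i % m ≡ g i % m) → (∑[ i < n ] f i) % m ≡ (∑[ i < n ] g i) % m
  ∑-%-cong zero    m fg = refl
  ∑-%-cong (suc n) m {f} {g} fg = begin
    (f zero + sum (f ∘ suc)) % m                   ≡⟨ %-distribˡ-+ (f zero) _ m ⟩
    (f zero % m + sum (f ∘ suc) % m) % m           ≡⟨ cong₂ (λ a b → (a + b) % m) (fg zero) (∑-%-cong n m (fg ∘ suc)) ⟩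
    (g zero % m + sum (g ∘ suc) % m) % m           ≡⟨ %-distribˡ-+ (g zero) _ m ⟨
    (g zero + sum (g ∘ suc)) % m                   ∎
    where open ≡-Reasoning

  zeroAt : ∀ {n} → Fin n → (Fin n → ℕ) → Fin n → ℕ
  zeroAt a f e = if does (e Fin.≟ a) then 0 else f e

  ∑-zeroAt : ∀ n (f : Fin n → ℕ) (a : Fin n) → ∑[ e < n ] f e ≡ f a + ∑[ e < n ] zeroAt a f e
  ∑-zeroAt (suc n) f zero    = refl
  ∑-zeroAt (suc n) f (suc a) = begin
    f zero + sum (f ∘ suc)                                      ≡⟨ cong (f zero +_) (∑-zeroAt n (f ∘ suc) a) ⟩
    f zero + (f (suc a) + sum (zeroAt a (f ∘ suc)))           ≡⟨ cong (λ s → f zero + (f (suc a) + s)) (sum-cong-≗ shift) ⟩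
    f zero + (f (suc a) + sum (zeroAt (suc a) f ∘ suc))       ≡⟨ +-assoc (f zero) _ _ ⟨
    f zero + f (suc a) + sum (zeroAt (suc a) f ∘ suc)         ≡⟨ cong (_+ sum (zeroAt (suc a) f ∘ suc)) (+-comm (f zero) _) ⟩
    f (suc a) + f zero + sum (zeroAt (suc a) f ∘ suc)         ≡⟨ +-assoc (f (suc a)) _ _ ⟩
    f (suc a) + sum (zeroAt (suc a) f)                        ∎
    where
    open ≡-Reasoning
    shift : ∀ i → zeroAt a (f ∘ suc) i ≡ zeroAt (suc a) f (suc i)
    shift i with i Fin.≟ a
    ... | yes refl = refl
    ... | no _     = refl

  ∑-reindex : ∀ k n (x : Fin k → Fin n) → Injective _≡_ _≡_ x → (f : Fin n → ℕ) →
              (∀ e → f e ≢ 0 → ∃ λ i → x i ≡ e) → ∑[ i < k ] f (x i) ≡ ∑[ e < n ] f e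
  ∑-reindex zero    n x x-inj f supp = sym (∑-zero n vanish)
    where
    vanish : ∀ e → f e ≡ 0
    vanish e with f e in fe
    ... | zero  = refl
    ... | suc _ with () ← supp e (λ fe≡0 → 0≢1+n (trans (sym fe≡0) fe))
  ∑-reindex (suc k) n x x-inj f supp = begin
    f (x zero) + ∑[ i < k ] f (x (suc i))                         ≡⟨ cong (f (x zero) +_) (sum-cong-≗ λ i → sym (zeroAt-off i)) ⟩
    f (x zero) + ∑[ i < k ] zeroAt (x zero) f (x (suc i))       ≡⟨ cong (f (x zero) +_)
                                                                       (∑-reindex k n (x ∘ suc) (Fin-suc-injective ∘ x-inj) _ supp′) ⟩
    f (x zero) + ∑[ e < n ] zeroAt (x zero) f e                 ≡⟨ ∑-zeroAt n f (x zero) ⟨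
    ∑[ e < n ] f e                                                ∎
    where
    open ≡-Reasoning
    x₀≢ : ∀ i → x (suc i) ≢ x zero
    x₀≢ i eq with () ← x-inj eq
    zeroAt-off : ∀ i → zeroAt (x zero) f (x (suc i)) ≡ f (x (suc i))
    zeroAt-off i with x (suc i) Fin.≟ x zero
    ... | yes eq = ⊥-elim (x₀≢ i eq)
    ... | no _   = refl
    supp′ : ∀ e → zeroAt (x zero) f e ≢ 0 → ∃ λ i → x (suc i) ≡ e
    supp′ e nz with e Fin.≟ x zero
    ... | yes _ = ⊥-elim (nz refl)
    ... | no e≢x₀ with supp e nz
    ...   | zero  , eq = ⊥-elim (e≢x₀ (sym eq))
    ...   | suc i , eq = i , eq

  %-cancel-suc : ∀ {p q} k → suc p % suc k ≡ suc q % suc k → p % suc k ≡ q % suc k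
  %-cancel-suc {p} {q} k eq = begin
    p % suc k                                      ≡⟨ [m+n]%n≡m%n p (suc k) ⟨
    (p + suc k) % suc k                            ≡⟨ cong (_% suc k) (+-suc p k) ⟩
    (suc p + k) % suc k                            ≡⟨ %-distribˡ-+ (suc p) k (suc k) ⟩
    (suc p % suc k + k % suc k) % suc k            ≡⟨ cong (λ r → (r + k % suc k) % suc k) eq ⟩
    (suc q % suc k + k % suc k) % suc k            ≡⟨ %-distribˡ-+ (suc q) k (suc k) ⟨
    (suc q + k) % suc k                            ≡⟨ cong (_% suc k) (+-suc q k) ⟨
    (q + suc k) % suc k                            ≡⟨ [m+n]%n≡m%n q (suc k) ⟩
    q % suc k                                      ∎
    where open ≡-Reasoning

  %-cancelˡ : ∀ a {x y} k → (a + x) % suc k ≡ (a + y) % suc k → x % suc k ≡ y % suc k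
  %-cancelˡ zero    k eq = eq
  %-cancelˡ (suc a) k eq = %-cancelˡ a k (%-cancel-suc k eq)

  lastOrInject : ∀ {n} (x : Fin (suc n)) → (∃ λ k → x ≡ inject₁ k) ⊎ x ≡ fromℕ n
  lastOrInject {zero}  zero    = inj₂ refl
  lastOrInject {suc n} zero    = inj₁ (zero , refl)
  lastOrInject {suc n} (suc x) with lastOrInject x
  ... | inj₁ (k , eq) = inj₁ (suc k , cong suc eq)
  ... | inj₂ eq       = inj₂ (cong suc eq)

  embed : ∀ {n} → Fin (n ∸ 1) → Fin n
  embed {suc n} = inject₁

  init-determines : ∀ {A : Set} (k : ℕ) (val : A → ℕ) → (∀ a → val a < suc k) → Injective _≡_ _≡_ val →
                    ∀ n (f g : Fin n → A) → (∑[ i < n ] val (f i)) % suc k ≡ (∑[ i < n ] val (g i)) % suc k →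
                    (∀ j → f (embed j) ≡ g (embed j)) → ∀ i → f i ≡ g i
  init-determines k val bounded val-inj (suc n) f g same-sum same-init i with lastOrInject i
  ... | inj₁ (j , refl) = same-init j
  ... | inj₂ refl       = val-inj (begin
    val (f (fromℕ n))                 ≡⟨ m<n⇒m%n≡m (bounded _) ⟨
    val (f (fromℕ n)) % suc k         ≡⟨ %-cancelˡ (∑[ j < n ] val (g (inject₁ j))) k last-sum ⟩
    val (g (fromℕ n)) % suc k         ≡⟨ m<n⇒m%n≡m (bounded _) ⟩
    val (g (fromℕ n))                 ∎)
    where
    open ≡-Reasoning
    init-sums : ∑[ j < n ] val (f (inject₁ j)) ≡ ∑[ j < n ] val (g (inject₁ j))
    init-sums = sum-cong-≗ {n} λ j → cong val (same-init j)
    last-sum : (∑[ j < n ] val (g (inject₁ j)) + val (f (fromℕ n))) % suc k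
             ≡ (∑[ j < n ] val (g (inject₁ j)) + val (g (fromℕ n))) % suc k
    last-sum = begin
      (∑[ j < n ] val (g (inject₁ j)) + val (f (fromℕ n))) % suc k  ≡⟨ cong (λ s → (s + val (f (fromℕ n))) % suc k) init-sums ⟨
      (∑[ j < n ] val (f (inject₁ j)) + val (f (fromℕ n))) % suc k  ≡⟨ cong (_% suc k) (sum-init-last (val ∘ f)) ⟨
      (∑[ i < suc n ] val (f i)) % suc k                              ≡⟨ same-sum ⟩
      (∑[ i < suc n ] val (g i)) % suc k                              ≡⟨ cong (_% suc k) (sum-init-last (val ∘ g)) ⟩
      (∑[ j < n ] val (g (inject₁ j)) + val (g (fromℕ n))) % suc k  ∎

  ∑-cocycle : ∀ n k (σ : Permutation′ n) (f g h : Fin n → ℕ) →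
              (∀ i → f i % suc k ≡ (g i + h (σ ⟨$⟩ʳ i)) % suc k) →
              (∑[ i < n ] g i) % suc k ≡ 0 → (∑[ i < n ] h i) % suc k ≡ 0 → (∑[ i < n ] f i) % suc k ≡ 0
  ∑-cocycle n k σ f g h cocycle g≡0 h≡0 = begin
    (∑[ i < n ] f i) % suc k                                    ≡⟨ ∑-%-cong n (suc k) cocycle ⟩
    (∑[ i < n ] (g i + h (σ ⟨$⟩ʳ i))) % suc k                    ≡⟨ cong (_% suc k) (∑-distrib-+ g (h ∘ (σ ⟨$⟩ʳ_))) ⟩
    (∑[ i < n ] g i + ∑[ i < n ] h (σ ⟨$⟩ʳ i)) % suc k          ≡⟨ cong (λ s → (∑[ i < n ] g i + s) % suc k) (∑-permute h σ) ⟨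
    (∑[ i < n ] g i + ∑[ i < n ] h i) % suc k                   ≡⟨ %-distribˡ-+ (∑[ i < n ] g i) _ (suc k) ⟩
    ((∑[ i < n ] g i) % suc k + (∑[ i < n ] h i) % suc k) % suc k ≡⟨ cong₂ (λ a b → (a + b) % suc k) g≡0 h≡0 ⟩
    0                                                           ∎
    where open ≡-Reasoning

module InversionParity where

  open FiniteSum

  ⟨$⟩ʳ-injective : ∀ {n} (π : Permutation′ n) → Injective _≡_ _≡_ (π ⟨$⟩ʳ_)
  ⟨$⟩ʳ-injective π = Injection.injective (Inverse⇒Injection π)

  𝟙 : Bool → ℕ
  𝟙 b = if b then 1 else 0

  _≺_ : ∀ {n} → Fin n → Fin n → Bool
  i ≺ j = toℕ i <ᵇ toℕ j

  ≺-irrefl : ∀ {n} (i : Fin n) → (i ≺ i) ≡ false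
  ≺-irrefl i = go (toℕ i)
    where
    go : ∀ m → (m <ᵇ m) ≡ false
    go zero    = refl
    go (suc m) = go m

  ≺-flip : ∀ {n} {i j : Fin n} → i ≢ j → (j ≺ i) ≡ not (i ≺ j)
  ≺-flip {i = i} {j} i≢j = go (toℕ i) (toℕ j) (i≢j ∘ toℕ-injective)
    where
    go : ∀ m n → m ≢ n → (n <ᵇ m) ≡ not (m <ᵇ n)
    go zero    zero    m≢n = ⊥-elim (m≢n refl)
    go zero    (suc n) _   = refl
    go (suc m) zero    _   = refl
    go (suc m) (suc n) m≢n = go m n (m≢n ∘ cong suc)

  ≺-asym : ∀ {n} (i j : Fin n) → (i ≺ j) ≡ true → (j ≺ i) ≡ false
  ≺-asym i j i≺j with i Fin.≟ j
  ... | yes refl = ≺-irrefl i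
  ... | no i≢j   = trans (≺-flip i≢j) (cong not i≺j)

  ∑² : ∀ n → (Fin n → Fin n → ℕ) → ℕ
  ∑² n h = ∑[ i < n ] ∑[ j < n ] h i j

  ∑²-cong : ∀ n {h k : Fin n → Fin n → ℕ} → (∀ i j → h i j ≡ k i j) → ∑² n h ≡ ∑² n k
  ∑²-cong n hk = sum-cong-≗ {n} λ i → sum-cong-≗ {n} (hk i)

  ∑²-+ : ∀ n (h k : Fin n → Fin n → ℕ) → ∑² n (λ i j → h i j + k i j) ≡ ∑² n h + ∑² n k
  ∑²-+ n h k = trans (sum-cong-≗ {n} λ i → ∑-distrib-+ (h i) (k i))
                     (∑-distrib-+ (λ i → ∑[ j < n ] h i j) (λ i → ∑[ j < n ] k i j))

  ∑²-2* : ∀ n (h : Fin n → Fin n → ℕ) → ∑² n (λ i j → 2 * h i j) ≡ 2 * ∑² n h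
  ∑²-2* n h = trans (sum-cong-≗ {n} λ i → ∑-2* n (h i)) (∑-2* n _)

  ∑²-permute : ∀ n (σ : Permutation′ n) (h : Fin n → Fin n → ℕ) →
               ∑² n (λ i j → h (σ ⟨$⟩ʳ i) (σ ⟨$⟩ʳ j)) ≡ ∑² n h
  ∑²-permute n σ h = sym (trans (∑-permute (λ x → ∑[ y < n ] h x y) σ)
                                (sum-cong-≗ {n} λ i → ∑-permute (h (σ ⟨$⟩ʳ i)) σ))

  -- Each unordered pair {i, j} with K i j is counted twice on the right.
  ∑²-halve : ∀ n (K : Fin n → Fin n → Bool) → (∀ i j → K i j ≡ K j i) → (∀ i → K i i ≡ false) →
             2 * ∑² n (λ i j → 𝟙 ((i ≺ j) ∧ K i j)) ≡ ∑² n (λ i j → 𝟙 (K i j))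
  ∑²-halve n K K-sym K-diag = begin
    2 * X                                                          ≡⟨ cong (X +_) (+-comm X 0) ⟩
    X + X                                                          ≡⟨ cong (X +_) transposed ⟩
    X + ∑² n (λ i j → 𝟙 ((j ≺ i) ∧ K i j))                         ≡⟨ ∑²-+ n _ _ ⟨
    ∑² n (λ i j → 𝟙 ((i ≺ j) ∧ K i j) + 𝟙 ((j ≺ i) ∧ K i j))       ≡⟨ ∑²-cong n split ⟩
    ∑² n (λ i j → 𝟙 (K i j))                                       ∎
    where
    open ≡-Reasoning
    X : ℕ
    X = ∑² n (λ i j → 𝟙 ((i ≺ j) ∧ K i j))
    transposed : X ≡ ∑² n (λ i j → 𝟙 ((j ≺ i) ∧ K i j))
    transposed = trans (∑-comm (λ i j → 𝟙 ((i ≺ j) ∧ K i j)))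
                       (∑²-cong n λ j i → cong (λ b → 𝟙 ((i ≺ j) ∧ b)) (K-sym i j))
    one-order : ∀ b k → 𝟙 (b ∧ k) + 𝟙 (not b ∧ k) ≡ 𝟙 k
    one-order false k     = refl
    one-order true  false = refl
    one-order true  true  = refl
    split : ∀ i j → 𝟙 ((i ≺ j) ∧ K i j) + 𝟙 ((j ≺ i) ∧ K i j) ≡ 𝟙 (K i j)
    split i j with i Fin.≟ j
    ... | yes refl rewrite K-diag i | ≺-irrefl i = refl
    ... | no i≢j   rewrite ≺-flip i≢j = one-order (i ≺ j) (K i j)

  inverted : ∀ {n} → (Fin n → Fin n) → Fin n → Fin n → ℕ
  inverted π i j = 𝟙 ((i ≺ j) ∧ (π j ≺ π i))

  inversions-∑² : ∀ {n} (π : Fin n → Fin n) → inversions π ≡ ∑² n (inverted π)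
  inversions-∑² {n} π = trans (listSum-allFin n _) (sum-cong-≗ {n} λ i → listSum-allFin n _)

  module Discordance {n} (π : Fin n → Fin n) (π-inj : Injective _≡_ _≡_ π) where

    discordant : Fin n → Fin n → Bool
    discordant x y = (x ≺ y) xor (π x ≺ π y)

    discordant-sym : ∀ x y → discordant x y ≡ discordant y x
    discordant-sym x y with x Fin.≟ y
    ... | yes refl = refl
    ... | no x≢y rewrite ≺-flip x≢y | ≺-flip (x≢y ∘ π-inj) = sym (xor-annihilates-not (x ≺ y) (π x ≺ π y))

    discordant-diag : ∀ x → discordant x x ≡ false
    discordant-diag x rewrite ≺-irrefl x | ≺-irrefl (π x) = refl

    ordered-discordant : ∀ x y → 𝟙 ((x ≺ y) ∧ discordant x y) ≡ inverted π x y
    ordered-discordant x y with x ≺ y in x≺y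
    ... | false = refl
    ... | true  with x Fin.≟ y
    ...   | yes refl with () ← trans (sym x≺y) (≺-irrefl x)
    ...   | no x≢y   = cong 𝟙 (sym (≺-flip (x≢y ∘ π-inj)))

    2*inversions : 2 * inversions π ≡ ∑² n (λ x y → 𝟙 (discordant x y))
    2*inversions = begin
      2 * inversions π                                          ≡⟨ cong (2 *_) (inversions-∑² π) ⟩
      2 * ∑² n (inverted π)                                     ≡⟨ cong (2 *_) (∑²-cong n ordered-discordant) ⟨
      2 * ∑² n (λ x y → 𝟙 ((x ≺ y) ∧ discordant x y))           ≡⟨ ∑²-halve n discordant discordant-sym discordant-diag ⟩
      ∑² n (λ x y → 𝟙 (discordant x y))                         ∎
      where open ≡-Reasoning

  -- The pairs inverted by σ and by π ∘ σ differ exactly in the pairs that π reverses.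
  inversions-∘ : ∀ {n} (π : Fin n → Fin n) → Injective _≡_ _≡_ π → (σ : Permutation′ n) →
                 ∃ λ d → inversions (π ∘ (σ ⟨$⟩ʳ_)) + inversions (σ ⟨$⟩ʳ_) ≡ inversions π + 2 * d
  inversions-∘ {n} π π-inj σ = ∑² n both , (begin
    inversions (π ∘ σ′) + inversions σ′                              ≡⟨ cong₂ _+_ (inversions-∑² (π ∘ σ′)) (inversions-∑² σ′) ⟩
    ∑² n (inverted (π ∘ σ′)) + ∑² n (inverted σ′)                    ≡⟨ ∑²-+ n _ _ ⟨
    ∑² n (λ i j → inverted (π ∘ σ′) i j + inverted σ′ i j)           ≡⟨ ∑²-cong n pointwise ⟩
    ∑² n (λ i j → discordant′ i j + 2 * both i j)                    ≡⟨ ∑²-+ n _ _ ⟩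
    ∑² n discordant′ + ∑² n (λ i j → 2 * both i j)                   ≡⟨ cong₂ _+_ ordered (∑²-2* n both) ⟩
    inversions π + 2 * ∑² n both                                     ∎)
    where
    open ≡-Reasoning
    open Discordance π π-inj
    σ′ : Fin n → Fin n
    σ′ = σ ⟨$⟩ʳ_
    discordant′ : Fin n → Fin n → ℕ
    discordant′ i j = 𝟙 ((i ≺ j) ∧ discordant (σ′ i) (σ′ j))
    both : Fin n → Fin n → ℕ
    both i j = 𝟙 ((i ≺ j) ∧ (π (σ′ j) ≺ π (σ′ i)) ∧ (σ′ j ≺ σ′ i))
    count : ∀ a b → 𝟙 (not b) + 𝟙 (not a) ≡ 𝟙 (a xor b) + 2 * 𝟙 (not b ∧ not a)
    count false false = refl
    count false true  = refl
    count true  false = refl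
    count true  true  = refl
    pointwise : ∀ i j → inverted (π ∘ σ′) i j + inverted σ′ i j ≡ discordant′ i j + 2 * both i j
    pointwise i j with i Fin.≟ j
    ... | yes refl rewrite ≺-irrefl i = refl
    ... | no i≢j with i ≺ j
    ...   | false = refl
    ...   | true rewrite ≺-flip (i≢j ∘ ⟨$⟩ʳ-injective σ) | ≺-flip (i≢j ∘ ⟨$⟩ʳ-injective σ ∘ π-inj)
            = count (σ′ i ≺ σ′ j) (π (σ′ i) ≺ π (σ′ j))
    ordered : ∑² n discordant′ ≡ inversions π
    ordered = *-cancelˡ-≡ _ _ 2 (begin
      2 * ∑² n discordant′                                      ≡⟨ ∑²-halve n (λ i j → discordant (σ′ i) (σ′ j))
                                                                      (λ i j → discordant-sym (σ′ i) (σ′ j))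
                                                                      (λ i → discordant-diag (σ′ i)) ⟩
      ∑² n (λ i j → 𝟙 (discordant (σ′ i) (σ′ j)))                ≡⟨ ∑²-permute n σ (λ x y → 𝟙 (discordant x y)) ⟩
      ∑² n (λ x y → 𝟙 (discordant x y))                          ≡⟨ 2*inversions ⟨
      2 * inversions π                                          ∎)

  inversions-cong : ∀ {n} {π ρ : Fin n → Fin n} → (∀ i → π i ≡ ρ i) → inversions π ≡ inversions ρ
  inversions-cong {n} {π} {ρ} π≗ρ = begin
    inversions π                ≡⟨ inversions-∑² π ⟩
    ∑² n (inverted π)           ≡⟨ ∑²-cong n (λ i j → cong₂ (λ a b → 𝟙 ((i ≺ j) ∧ (a ≺ b))) (π≗ρ j) (π≗ρ i)) ⟩
    ∑² n (inverted ρ)           ≡⟨ inversions-∑² ρ ⟨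
    inversions ρ                ∎
    where open ≡-Reasoning

  inversions-id : ∀ n → inversions {n} (λ i → i) ≡ 0
  inversions-id n = trans (inversions-∑² {n} (λ i → i)) (∑-zero n λ i → ∑-zero n λ j → never i j)
    where
    never : ∀ i j → inverted (λ i → i) i j ≡ 0
    never i j with i ≺ j in i≺j
    ... | false = refl
    ... | true rewrite ≺-asym i j i≺j = refl

  parity : ∀ {n} → Permutation′ n → ℕ
  parity π = inversions (π ⟨$⟩ʳ_) % 2

  parity-cong : ∀ {n} {π ρ : Permutation′ n} → π ≈ₚ ρ → parity π ≡ parity ρ
  parity-cong π≈ρ = cong (_% 2) (inversions-cong π≈ρ)

  parity-id : ∀ {n} → parity (idₚ {n}) ≡ 0
  parity-id {n} = cong (_% 2) (inversions-id n)

  parity-∘ₚ : ∀ {n} (σ π : Permutation′ n) → parity (σ ∘ₚ π) ≡ (parity π + parity σ) % 2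
  parity-∘ₚ σ π with d , eq ← inversions-∘ (π ⟨$⟩ʳ_) (⟨$⟩ʳ-injective π) σ = begin
    a % 2                          ≡⟨ [m+kn]%n≡m%n a s 2 ⟨
    (a + s * 2) % 2                ≡⟨ cong (λ t → (a + t) % 2) (*-comm s 2) ⟩
    (a + 2 * s) % 2                ≡⟨ cong (_% 2) shuffle ⟩
    (p + s + d * 2) % 2            ≡⟨ [m+kn]%n≡m%n (p + s) d 2 ⟩
    (p + s) % 2                    ≡⟨ %-distribˡ-+ p s 2 ⟩
    (p % 2 + s % 2) % 2            ∎
    where
    open ≡-Reasoning
    a s p : ℕ
    a = inversions ((σ ∘ₚ π) ⟨$⟩ʳ_)
    s = inversions (σ ⟨$⟩ʳ_)
    p = inversions (π ⟨$⟩ʳ_)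
    shuffle : a + 2 * s ≡ p + s + d * 2
    shuffle = begin
      a + (s + (s + 0))          ≡⟨ cong (λ t → a + (s + t)) (+-comm s 0) ⟩
      a + (s + s)                ≡⟨ +-assoc a s s ⟨
      a + s + s                  ≡⟨ cong (_+ s) eq ⟩
      p + 2 * d + s              ≡⟨ +-assoc p _ s ⟩
      p + (2 * d + s)            ≡⟨ cong (p +_) (+-comm (2 * d) s) ⟩
      p + (s + 2 * d)            ≡⟨ +-assoc p s _ ⟨
      p + s + 2 * d              ≡⟨ cong (p + s +_) (*-comm 2 d) ⟩
      p + s + d * 2              ∎

  module _ {n} (a b : Fin n) where

    transpose-left : transpose a b ⟨$⟩ʳ a ≡ b
    transpose-left rewrite dec-true (a Fin.≟ a) refl = refl

    transpose-right : transpose a b ⟨$⟩ʳ b ≡ a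
    transpose-right with a Fin.≟ b
    ... | yes refl = transpose-left
    ... | no a≢b rewrite dec-false (b Fin.≟ a) (a≢b ∘ sym) | dec-true (b Fin.≟ b) refl = refl

    transpose-other : ∀ {x} → x ≢ a → x ≢ b → transpose a b ⟨$⟩ʳ x ≡ x
    transpose-other {x} x≢a x≢b rewrite dec-false (x Fin.≟ a) x≢a | dec-false (x Fin.≟ b) x≢b = refl

  transpose-comm : ∀ {n} (a b : Fin n) → transpose a b ≈ₚ transpose b a
  transpose-comm a b x with toSum (x Fin.≟ a) | toSum (x Fin.≟ b)
  ... | inj₁ refl | _        = trans (transpose-left x b) (sym (transpose-right b x))
  ... | inj₂ _     | inj₁ refl = trans (transpose-right a x) (sym (transpose-left x a))
  ... | inj₂ x≢a   | inj₂ x≢b   = trans (transpose-other a b x≢a x≢b) (sym (transpose-other b a x≢b x≢a))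

  module _ {n} {a b c : Fin n} (a≢b : a ≢ b) (a≢c : a ≢ c) (b≢c : b ≢ c) where

    private
      tac tbc : Permutation′ n
      tac = transpose a c
      tbc = transpose b c

    transpose-conj : transpose a b ≈ₚ tac ∘ₚ tbc ∘ₚ tac
    transpose-conj x with toSum (x Fin.≟ a) | toSum (x Fin.≟ b) | toSum (x Fin.≟ c)
    ... | inj₁ refl | _ | _ = begin
      transpose a b ⟨$⟩ʳ a             ≡⟨ transpose-left a b ⟩
      b                               ≡⟨ transpose-other a c (a≢b ∘ sym) b≢c ⟨
      tac ⟨$⟩ʳ b                       ≡⟨ cong (tac ⟨$⟩ʳ_) (transpose-right b c) ⟨
      tac ⟨$⟩ʳ (tbc ⟨$⟩ʳ c)             ≡⟨ cong (λ y → tac ⟨$⟩ʳ (tbc ⟨$⟩ʳ y)) (transpose-left a c) ⟨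
      tac ⟨$⟩ʳ (tbc ⟨$⟩ʳ (tac ⟨$⟩ʳ a))  ∎
      where open ≡-Reasoning
    ... | inj₂ _ | inj₁ refl | _ = begin
      transpose a b ⟨$⟩ʳ b             ≡⟨ transpose-right a b ⟩
      a                               ≡⟨ transpose-right a c ⟨
      tac ⟨$⟩ʳ c                       ≡⟨ cong (tac ⟨$⟩ʳ_) (transpose-left b c) ⟨
      tac ⟨$⟩ʳ (tbc ⟨$⟩ʳ b)             ≡⟨ cong (λ y → tac ⟨$⟩ʳ (tbc ⟨$⟩ʳ y)) (transpose-other a c (a≢b ∘ sym) b≢c) ⟨
      tac ⟨$⟩ʳ (tbc ⟨$⟩ʳ (tac ⟨$⟩ʳ b))  ∎
      where open ≡-Reasoning
    ... | inj₂ _ | inj₂ _ | inj₁ refl = begin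
      transpose a b ⟨$⟩ʳ c             ≡⟨ transpose-other a b (a≢c ∘ sym) (b≢c ∘ sym) ⟩
      c                               ≡⟨ transpose-left a c ⟨
      tac ⟨$⟩ʳ a                       ≡⟨ cong (tac ⟨$⟩ʳ_) (transpose-other b c a≢b a≢c) ⟨
      tac ⟨$⟩ʳ (tbc ⟨$⟩ʳ a)             ≡⟨ cong (λ y → tac ⟨$⟩ʳ (tbc ⟨$⟩ʳ y)) (transpose-right a c) ⟨
      tac ⟨$⟩ʳ (tbc ⟨$⟩ʳ (tac ⟨$⟩ʳ c))  ∎
      where open ≡-Reasoning
    ... | inj₂ x≢a | inj₂ x≢b | inj₂ x≢c = begin
      transpose a b ⟨$⟩ʳ x             ≡⟨ transpose-other a b x≢a x≢b ⟩
      x                               ≡⟨ transpose-other a c x≢a x≢c ⟨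
      tac ⟨$⟩ʳ x                       ≡⟨ cong (tac ⟨$⟩ʳ_) (transpose-other b c x≢b x≢c) ⟨
      tac ⟨$⟩ʳ (tbc ⟨$⟩ʳ x)             ≡⟨ cong (λ y → tac ⟨$⟩ʳ (tbc ⟨$⟩ʳ y)) (transpose-other a c x≢a x≢c) ⟨
      tac ⟨$⟩ʳ (tbc ⟨$⟩ʳ (tac ⟨$⟩ʳ x))  ∎
      where open ≡-Reasoning

    parity-transpose-conj : parity (transpose a b) ≡ parity (transpose b c)
    parity-transpose-conj = begin
      parity (transpose a b)                                ≡⟨ parity-cong {π = transpose a b} {ρ = tac ∘ₚ tbc ∘ₚ tac} transpose-conj ⟩
      parity (tac ∘ₚ tbc ∘ₚ tac)                            ≡⟨ parity-∘ₚ tac (tbc ∘ₚ tac) ⟩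
      (parity (tbc ∘ₚ tac) + parity tac) % 2                ≡⟨ cong (λ p → (p + parity tac) % 2) (parity-∘ₚ tbc tac) ⟩
      ((parity tac + parity tbc) % 2 + parity tac) % 2      ≡⟨ cancel (inversions (tac ⟨$⟩ʳ_)) (inversions (tbc ⟨$⟩ʳ_)) ⟩
      parity tbc                                            ∎
      where
      open ≡-Reasoning
      cancel : ∀ x y → ((x % 2 + y % 2) % 2 + x % 2) % 2 ≡ y % 2
      cancel x y with x % 2 | y % 2 | m%n<n x 2 | m%n<n y 2
      ... | 0 | 0 | _ | _ = refl
      ... | 0 | 1 | _ | _ = refl
      ... | 1 | 0 | _ | _ = refl
      ... | 1 | 1 | _ | _ = refl
      ... | suc (suc _) | _ | s≤s (s≤s ()) | _
      ... | _ | suc (suc _) | _ | s≤s (s≤s ())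

  inversions-transpose-01 : ∀ m → inversions (transpose {suc (suc m)} zero (suc zero) ⟨$⟩ʳ_) ≡ 1
  inversions-transpose-01 m = trans (inversions-∑² t)
    (cong₂ _+_ (cong (1 +_) (∑-zero m λ _ → refl))
               (cong₂ _+_ (∑-zero m λ _ → refl) (∑-zero m λ i → ∑-zero (suc (suc m)) (lower-rows i))))
    where
    t : Fin (suc (suc m)) → Fin (suc (suc m))
    t = transpose zero (suc zero) ⟨$⟩ʳ_
    lower-rows : ∀ i j → inverted t (suc (suc i)) j ≡ 0
    lower-rows i zero          = refl
    lower-rows i (suc zero)    = refl
    lower-rows i (suc (suc j)) with i ≺ j in i≺j
    ... | false = refl
    ... | true  rewrite ≺-asym i j i≺j = refl

  parity-transpose : ∀ {n} {a b : Fin n} → a ≢ b → parity (transpose a b) ≡ 1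
  parity-transpose {suc (suc m)} {a} {b} = go a b
    where
    0F 1F : Fin (suc (suc m))
    0F = zero
    1F = suc zero
    0≢1 : 0F ≢ 1F
    0≢1 ()
    base : parity (transpose 0F 1F) ≡ 1
    base = cong (_% 2) (inversions-transpose-01 m)
    base′ : parity (transpose 1F 0F) ≡ 1
    base′ = trans (parity-cong {π = transpose 1F 0F} {ρ = transpose 0F 1F} (transpose-comm 1F 0F)) base
    from-0 : ∀ b → 0F ≢ b → parity (transpose 0F b) ≡ 1
    from-0 b 0≢b with toSum (b Fin.≟ 1F)
    ... | inj₁ refl = base
    ... | inj₂ b≢1  = trans (parity-transpose-conj 0≢b 0≢1 b≢1) (trans (parity-transpose-conj b≢1 (0≢b ∘ sym) (0≢1 ∘ sym)) base′)
    to-0 : ∀ a → a ≢ 0F → parity (transpose a 0F) ≡ 1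
    to-0 a a≢0 with toSum (a Fin.≟ 1F)
    ... | inj₁ refl = base′
    ... | inj₂ a≢1  = trans (parity-transpose-conj a≢0 a≢1 0≢1) base
    go : ∀ a b → a ≢ b → parity (transpose a b) ≡ 1
    go zero    b       a≢b = from-0 b a≢b
    go (suc a) zero    _   = to-0 (suc a) λ ()
    go (suc a) (suc b) a≢b = trans (parity-transpose-conj {c = 0F} a≢b (λ ()) (λ ())) (to-0 (suc b) λ ())
  parity-transpose {suc zero} {zero} {zero} 0≢0 = ⊥-elim (0≢0 refl)

  𝟙<2 : ∀ b → 𝟙 b < 2
  𝟙<2 false = s≤s z≤n
  𝟙<2 true  = s≤s (s≤s z≤n)

  𝟙-injective : Injective _≡_ _≡_ 𝟙
  𝟙-injective {false} {false} _ = refl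
  𝟙-injective {true}  {true}  _ = refl

module Cycle where

  open InversionParity
  open FiniteSum

  csuc-view : ∀ {n} (i : Fin (suc n)) →
              (toℕ i < n × toℕ (csuc i) ≡ suc (toℕ i)) ⊎ (toℕ i ≡ n × csuc i ≡ zero)
  csuc-view {n} i with suc (toℕ i) <ℕ? suc n
  ... | yes i+1<n+1 = inj₁ (s≤s⁻¹ i+1<n+1 , toℕ-fromℕ< i+1<n+1)
  ... | no  i+1≮n+1 = inj₂ (≤∧≮⇒≡ (s≤s⁻¹ (toℕ<n i)) (i+1≮n+1 ∘ s≤s) , refl)

  cpred-csuc : ∀ {n} (i : Fin n) → cpred (csuc i) ≡ i
  cpred-csuc {suc n} i with csuc i | csuc-view i
  ... | zero  | inj₁ (_ , ())
  ... | suc j | inj₁ (_ , eq) = toℕ-injective (trans (toℕ-inject₁ j) (suc-injective eq))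
  ... | zero  | inj₂ (eq , _) = toℕ-injective (trans (toℕ-fromℕ n) (sym eq))
  ... | suc j | inj₂ (_ , ())

  csuc-cpred : ∀ {n} (i : Fin n) → csuc (cpred i) ≡ i
  csuc-cpred {suc n} zero with csuc-view (fromℕ n)
  ... | inj₁ (n<n , _) = ⊥-elim (<-irrefl (toℕ-fromℕ n) n<n)
  ... | inj₂ (_ , eq)  = eq
  csuc-cpred {suc n} (suc j) with csuc-view (inject₁ j)
  ... | inj₁ (_ , eq) = toℕ-injective (trans eq (cong suc (toℕ-inject₁ j)))
  ... | inj₂ (eq , _) = ⊥-elim (<⇒≢ (toℕ<n j) (trans (sym (toℕ-inject₁ j)) eq))

  csuc-injective : ∀ {n} → Injective _≡_ _≡_ (csuc {n})
  csuc-injective {x = i} {j} eq = trans (sym (cpred-csuc i)) (trans (cong cpred eq) (cpred-csuc j))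

  csucₚ : ∀ {n} → Permutation′ n
  csucₚ = permutation csuc cpred csuc-cpred cpred-csuc

  csuc-zero : ∀ q → csuc {suc (suc q)} zero ≡ suc zero
  csuc-zero q with csuc-view {suc q} zero
  ... | inj₁ (_ , eq) = toℕ-injective eq
  ... | inj₂ (() , _)

  csuc-singleton : csuc {1} zero ≡ zero
  csuc-singleton with csuc-view {0} zero
  ... | inj₁ (() , _)
  ... | inj₂ (_ , eq) = eq

  csuc-suc : ∀ {q} (k : Fin (suc q)) →
             (csuc k ≡ zero × csuc {suc (suc q)} (suc k) ≡ zero) ⊎ (csuc k ≢ zero × csuc {suc (suc q)} (suc k) ≡ suc (csuc k))
  csuc-suc {q} k with csuc-view k | csuc-view {suc q} (suc k)
  ... | inj₁ (_ , eq) | inj₁ (_ , eq′) = inj₂ ((λ z → 0≢1+n (trans (sym (cong toℕ z)) eq)) , toℕ-injective (trans eq′ (cong suc (sym eq))))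
  ... | inj₁ (k<q , _) | inj₂ (eq′ , _) = ⊥-elim (<⇒≢ k<q (suc-injective eq′))
  ... | inj₂ (eq , _) | inj₁ (k<q , _) = ⊥-elim (<⇒≢ (s≤s⁻¹ k<q) eq)
  ... | inj₂ (_ , z) | inj₂ (_ , z′) = inj₁ (z , z′)

  shiftAlong : ∀ {p n} → (Fin p → Fin n) → (Fin p → Fin p) → Fin n → Fin n
  shiftAlong x s w with any? (λ i → x i Fin.≟ w)
  ... | yes (i , _) = x (s i)
  ... | no _        = w

  module _ {p n} (x : Fin p → Fin n) (x-inj : Injective _≡_ _≡_ x) where

    shiftAlong-on : ∀ s i → shiftAlong x s (x i) ≡ x (s i)
    shiftAlong-on s i with any? (λ j → x j Fin.≟ x i)
    ... | yes (j , xj≡xi) = cong (x ∘ s) (x-inj xj≡xi)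
    ... | no  x≢xi        = ⊥-elim (x≢xi (i , refl))

    shiftAlong-off : ∀ s {w} → (∀ i → x i ≢ w) → shiftAlong x s w ≡ w
    shiftAlong-off s {w} off with any? (λ j → x j Fin.≟ w)
    ... | yes (j , xj≡w) = ⊥-elim (off j xj≡w)
    ... | no  _          = refl

    shiftAlong-inverse : ∀ {s t} → (∀ i → s (t i) ≡ i) → ∀ w → shiftAlong x s (shiftAlong x t w) ≡ w
    shiftAlong-inverse {s} {t} st w with any? (λ j → x j Fin.≟ w)
    ... | yes (i , refl) = trans (shiftAlong-on s (t i)) (cong x (st i))
    ... | no  off        = shiftAlong-off s (λ i xi≡w → off (i , xi≡w))

    cycle : Permutation′ n
    cycle = permutation (shiftAlong x csuc) (shiftAlong x cpred)
                        (shiftAlong-inverse csuc-cpred) (shiftAlong-inverse cpred-csuc)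

    cycle-on : ∀ i → cycle ⟨$⟩ʳ x i ≡ x (csuc i)
    cycle-on = shiftAlong-on csuc

    cycle-off : ∀ {w} → (∀ i → x i ≢ w) → cycle ⟨$⟩ʳ w ≡ w
    cycle-off = shiftAlong-off csuc

  onSequence? : ∀ {p n} (x : Fin p → Fin n) w → (∃ λ i → x i ≡ w) ⊎ (∀ i → x i ≢ w)
  onSequence? x w with any? (λ i → x i Fin.≟ w)
  ... | yes found = inj₁ found
  ... | no  off   = inj₂ λ i xi≡w → off (i , xi≡w)

  module _ {q n} (x : Fin (suc (suc q)) → Fin n) (x-inj : Injective _≡_ _≡_ x) where
    private
      tail-inj : Injective _≡_ _≡_ (x ∘ suc)
      tail-inj = Fin-suc-injective ∘ x-inj
      t c : Permutation′ n
      t = transpose (x zero) (x (suc zero))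
      c = cycle (x ∘ suc) tail-inj
      x≢x0 : ∀ {i} → x (suc i) ≢ x zero
      x≢x0 eq with () ← x-inj eq
      x≢x1 : ∀ {i} → i ≢ zero → x (suc i) ≢ x (suc zero)
      x≢x1 i≢0 eq = i≢0 (tail-inj eq)
      x0≢x1 : x zero ≢ x (suc zero)
      x0≢x1 eq with () ← x-inj eq

    cycle-split : cycle x x-inj ≈ₚ c ∘ₚ t
    cycle-split w with onSequence? x w
    ... | inj₂ off = trans (cycle-off x x-inj off)
                       (sym (trans (cong (t ⟨$⟩ʳ_) (cycle-off (x ∘ suc) tail-inj (off ∘ suc)))
                                   (transpose-other (x zero) (x (suc zero)) (off zero ∘ sym) (off (suc zero) ∘ sym))))
    ... | inj₁ (zero , refl) = begin
      cycle x x-inj ⟨$⟩ʳ x zero     ≡⟨ cycle-on x x-inj zero ⟩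
      x (csuc zero)                ≡⟨ cong x (csuc-zero q) ⟩
      x (suc zero)                 ≡⟨ transpose-left (x zero) (x (suc zero)) ⟨
      t ⟨$⟩ʳ x zero                 ≡⟨ cong (t ⟨$⟩ʳ_) (cycle-off (x ∘ suc) tail-inj (λ i → x≢x0)) ⟨
      t ⟨$⟩ʳ (c ⟨$⟩ʳ x zero)        ∎
      where open ≡-Reasoning
    ... | inj₁ (suc k , refl) with csuc-suc k
    ...   | inj₁ (csuc-k≡0 , csuc-suc-k≡0) = begin
      cycle x x-inj ⟨$⟩ʳ x (suc k)  ≡⟨ cycle-on x x-inj (suc k) ⟩
      x (csuc (suc k))             ≡⟨ cong x csuc-suc-k≡0 ⟩
      x zero                       ≡⟨ transpose-right (x zero) (x (suc zero)) ⟨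
      t ⟨$⟩ʳ x (suc zero)           ≡⟨ cong (λ i → t ⟨$⟩ʳ x (suc i)) csuc-k≡0 ⟨
      t ⟨$⟩ʳ x (suc (csuc k))       ≡⟨ cong (t ⟨$⟩ʳ_) (cycle-on (x ∘ suc) tail-inj k) ⟨
      t ⟨$⟩ʳ (c ⟨$⟩ʳ x (suc k))     ∎
      where open ≡-Reasoning
    ...   | inj₂ (csuc-k≢0 , csuc-suc-k≡suc) = begin
      cycle x x-inj ⟨$⟩ʳ x (suc k)  ≡⟨ cycle-on x x-inj (suc k) ⟩
      x (csuc (suc k))             ≡⟨ cong x csuc-suc-k≡suc ⟩
      x (suc (csuc k))             ≡⟨ transpose-other (x zero) (x (suc zero)) x≢x0 (x≢x1 csuc-k≢0) ⟨
      t ⟨$⟩ʳ x (suc (csuc k))       ≡⟨ cong (t ⟨$⟩ʳ_) (cycle-on (x ∘ suc) tail-inj k) ⟨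
      t ⟨$⟩ʳ (c ⟨$⟩ʳ x (suc k))     ∎
      where open ≡-Reasoning

    parity-cycle-split : parity (cycle x x-inj) ≡ (1 + parity (cycle (x ∘ suc) (Fin-suc-injective ∘ x-inj))) % 2
    parity-cycle-split = begin
      parity (cycle x x-inj)        ≡⟨ parity-cong {π = cycle x x-inj} {ρ = c ∘ₚ t} cycle-split ⟩
      parity (c ∘ₚ t)               ≡⟨ parity-∘ₚ c t ⟩
      (parity t + parity c) % 2     ≡⟨ cong (λ r → (r + parity c) % 2) (parity-transpose x0≢x1) ⟩
      (1 + parity c) % 2            ∎
      where open ≡-Reasoning

  parity-cycle : ∀ {p n} (x : Fin p → Fin n) (x-inj : Injective _≡_ _≡_ x) → parity (cycle x x-inj) ≡ (p ∸ 1) % 2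
  parity-cycle {zero} {n} x x-inj = trans (parity-cong {π = cycle x x-inj} {ρ = idₚ} (λ w → cycle-off x x-inj λ ())) (parity-id {n})
  parity-cycle {suc zero} {n} x x-inj = trans (parity-cong {π = cycle x x-inj} {ρ = idₚ} fixed) (parity-id {n})
    where
    fixed : ∀ w → cycle x x-inj ⟨$⟩ʳ w ≡ w
    fixed w with onSequence? x w
    ... | inj₁ (zero , refl) = trans (cycle-on x x-inj zero) (cong x csuc-singleton)
    ... | inj₂ off           = cycle-off x x-inj off
  parity-cycle {suc (suc q)} x x-inj = begin
    parity (cycle x x-inj)                            ≡⟨ parity-cycle-split x x-inj ⟩
    (1 + parity (cycle (x ∘ suc) tail-inj)) % 2       ≡⟨ cong (λ r → (1 + r) % 2) (parity-cycle (x ∘ suc) tail-inj) ⟩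
    (1 + q % 2) % 2                                   ≡⟨ %-distribˡ-+ 1 q 2 ⟨
    suc q % 2                                         ∎
    where
    open ≡-Reasoning
    tail-inj : Injective _≡_ _≡_ (x ∘ suc)
    tail-inj = Fin-suc-injective ∘ x-inj

  ∑-telescope : ∀ p k (c d : Fin p → ℕ) → (∀ i → (c i + d i) % suc k ≡ c (csuc i) % suc k) →
                (∑[ i < p ] d i) % suc k ≡ 0
  ∑-telescope p k c d increments = %-cancelˡ (∑[ i < p ] c i) k (begin
    (∑[ i < p ] c i + ∑[ i < p ] d i) % suc k         ≡⟨ cong (_% suc k) (∑-distrib-+ c d) ⟨
    (∑[ i < p ] (c i + d i)) % suc k                  ≡⟨ ∑-%-cong p (suc k) increments ⟩
    (∑[ i < p ] c (csuc i)) % suc k                   ≡⟨ cong (_% suc k) (∑-permute c csucₚ) ⟨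
    (∑[ i < p ] c i) % suc k                          ≡⟨ cong (_% suc k) (+-identityʳ (∑[ i < p ] c i)) ⟨
    (∑[ i < p ] c i + 0) % suc k                      ∎)
    where open ≡-Reasoning

module Three where

  ExactlyThree : {X : Set} → (X → Set) → Set
  ExactlyThree {X} P = Σ X λ F₁ → Σ X λ F₂ → Σ X λ F₃ →
    F₁ ≢ F₂ × F₁ ≢ F₃ × F₂ ≢ F₃ × P F₁ × P F₂ × P F₃ ×
    (∀ H → P H → H ≡ F₁ ⊎ H ≡ F₂ ⊎ H ≡ F₃)

  module _ {X : Set} {P : X → Set} where

    three-exhaust : ExactlyThree P → ∀ {a b c d} → P a → P b → P c → P d →
                    a ≢ b → a ≢ c → b ≢ c → d ≡ a ⊎ d ≡ b ⊎ d ≡ c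
    three-exhaust (F₁ , F₂ , F₃ , _ , _ , _ , _ , _ , _ , members) {a} {b} {c} {d} pa pb pc pd a≢b a≢c b≢c
      = collision (pigeonhole (s≤s (s≤s (s≤s (s≤s z≤n)))) (λ k → index (member k)))
      where
      enum : Fin 3 → X
      enum zero       = F₁
      enum (suc zero) = F₂
      enum (suc (suc zero)) = F₃
      index : ∀ {x} → x ≡ F₁ ⊎ x ≡ F₂ ⊎ x ≡ F₃ → Fin 3
      index (inj₁ _)        = zero
      index (inj₂ (inj₁ _)) = suc zero
      index (inj₂ (inj₂ _)) = suc (suc zero)
      enum-index : ∀ {x} (m : x ≡ F₁ ⊎ x ≡ F₂ ⊎ x ≡ F₃) → enum (index m) ≡ x
      enum-index (inj₁ refl)        = refl
      enum-index (inj₂ (inj₁ refl)) = refl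
      enum-index (inj₂ (inj₂ refl)) = refl
      element : Fin 4 → X
      element zero = a
      element (suc zero) = b
      element (suc (suc zero)) = c
      element (suc (suc (suc zero))) = d
      member : ∀ k → element k ≡ F₁ ⊎ element k ≡ F₂ ⊎ element k ≡ F₃
      member zero = members a pa
      member (suc zero) = members b pb
      member (suc (suc zero)) = members c pc
      member (suc (suc (suc zero))) = members d pd
      collide : ∀ i j → i Fin.< j → element i ≡ element j → d ≡ a ⊎ d ≡ b ⊎ d ≡ c
      collide zero (suc zero) _ eq = ⊥-elim (a≢b eq)
      collide zero (suc (suc zero)) _ eq = ⊥-elim (a≢c eq)
      collide zero (suc (suc (suc zero))) _ eq = inj₁ (sym eq)
      collide (suc zero) (suc (suc zero)) _ eq = ⊥-elim (b≢c eq)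
      collide (suc zero) (suc (suc (suc zero))) _ eq = inj₂ (inj₁ (sym eq))
      collide (suc (suc zero)) (suc (suc (suc zero))) _ eq = inj₂ (inj₂ (sym eq))
      collide zero zero (() ) _
      collide (suc zero) zero () _
      collide (suc zero) (suc zero) (s≤s ()) _
      collide (suc (suc zero)) zero () _
      collide (suc (suc zero)) (suc zero) (s≤s ()) _
      collide (suc (suc zero)) (suc (suc zero)) (s≤s (s≤s ())) _
      collide (suc (suc (suc zero))) zero () _
      collide (suc (suc (suc zero))) (suc zero) (s≤s ()) _
      collide (suc (suc (suc zero))) (suc (suc zero)) (s≤s (s≤s ())) _
      collide (suc (suc (suc zero))) (suc (suc (suc zero))) (s≤s (s≤s (s≤s ()))) _
      collision : (∃₂ λ i j → i Fin.< j × index (member i) ≡ index (member j)) → d ≡ a ⊎ d ≡ b ⊎ d ≡ c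
      collision (i , j , i<j , same) = collide i j i<j (trans (sym (enum-index (member i))) (trans (cong enum same) (enum-index (member j))))

    three-other : ExactlyThree P → ∀ {a b} → P a → P b → a ≢ b → ∃ λ c → P c × c ≢ a × c ≢ b
    three-other (F₁ , F₂ , F₃ , d₁₂ , d₁₃ , d₂₃ , p₁ , p₂ , p₃ , members) {a} {b} pa pb a≢b
      with members a pa | members b pb
    ... | inj₁ refl        | inj₁ refl        = ⊥-elim (a≢b refl)
    ... | inj₁ refl        | inj₂ (inj₁ refl) = F₃ , p₃ , d₁₃ ∘ sym , d₂₃ ∘ sym
    ... | inj₁ refl        | inj₂ (inj₂ refl) = F₂ , p₂ , d₁₂ ∘ sym , d₂₃
    ... | inj₂ (inj₁ refl) | inj₁ refl        = F₃ , p₃ , d₂₃ ∘ sym , d₁₃ ∘ sym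
    ... | inj₂ (inj₁ refl) | inj₂ (inj₁ refl) = ⊥-elim (a≢b refl)
    ... | inj₂ (inj₁ refl) | inj₂ (inj₂ refl) = F₁ , p₁ , d₁₂ , d₁₃
    ... | inj₂ (inj₂ refl) | inj₁ refl        = F₂ , p₂ , d₂₃ , d₁₂ ∘ sym
    ... | inj₂ (inj₂ refl) | inj₂ (inj₁ refl) = F₁ , p₁ , d₁₃ , d₁₂
    ... | inj₂ (inj₂ refl) | inj₂ (inj₂ refl) = ⊥-elim (a≢b refl)

  module ThreeCycle {X : Set} {P : X → Set} (three : ExactlyThree P) (f : X → X)
                    (f-closed : ∀ {x} → P x → P (f x))
                    (f-injective : ∀ {x y} → P x → P y → f x ≡ f y → x ≡ y)
                    (f-no-fix : ∀ {x} → P x → f x ≢ x) where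

    f²-no-fix : ∀ {x} → P x → f (f x) ≢ x
    f²-no-fix {x} px f²x≡x = impossible (three-other three px pfx (f-no-fix px ∘ sym))
      where
      pfx : P (f x)
      pfx = f-closed px
      impossible : (∃ λ c → P c × c ≢ x × c ≢ f x) → ⊥
      impossible (c , pc , c≢x , c≢fx)
        with three-exhaust three px pfx pc (f-closed pc) (f-no-fix px ∘ sym) (c≢x ∘ sym) (c≢fx ∘ sym)
      ... | inj₁ fc≡x         = c≢fx (f-injective pc pfx (trans fc≡x (sym f²x≡x)))
      ... | inj₂ (inj₁ fc≡fx) = c≢x (f-injective pc px fc≡fx)
      ... | inj₂ (inj₂ fc≡c)  = f-no-fix pc fc≡c

    orbit : ∀ {x y} → P x → P y → y ≡ x ⊎ y ≡ f x ⊎ y ≡ f (f x)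
    orbit px py = three-exhaust three px (f-closed px) (f-closed (f-closed px)) py
                    (f-no-fix px ∘ sym) (f²-no-fix px ∘ sym) (f-no-fix (f-closed px) ∘ sym)

    f³≡id : ∀ {x} → P x → f (f (f x)) ≡ x
    f³≡id {x} px = in-orbit (orbit px pf³x)
      where
      pf²x : P (f (f x))
      pf²x = f-closed (f-closed px)
      pf³x : P (f (f (f x)))
      pf³x = f-closed pf²x
      in-orbit : f (f (f x)) ≡ x ⊎ f (f (f x)) ≡ f x ⊎ f (f (f x)) ≡ f (f x) → f (f (f x)) ≡ x
      in-orbit (inj₁ f³x≡x)          = f³x≡x
      in-orbit (inj₂ (inj₁ f³x≡fx))  = ⊥-elim (f²-no-fix px (f-injective pf²x px f³x≡fx))
      in-orbit (inj₂ (inj₂ f³x≡f²x)) = ⊥-elim (f-no-fix pf²x f³x≡f²x)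

module MapGeometry (M : Map3) (Hy : IsOriented3ValentMap M) where

  open Cycle
  open Three
  open Map3 M
  open IsOriented3ValentMap Hy

  vtx-injective : ∀ F → Injective _≡_ _≡_ (vtx F)
  vtx-injective F = vtx-inj F _ _

  edg-injective : ∀ F → Injective _≡_ _≡_ (edg F)
  edg-injective F = edg-inj F _ _

  HasEdge : Fin nF → Fin nE → Set
  HasEdge H x = ∃ λ k → edg H k ≡ x

  posV-at : ∀ F i → posV M F (vtx F i) ≡ just i
  posV-at F i with any? (λ j → vtx F j Fin.≟ vtx F i)
  ... | yes (j , eq) = cong just (vtx-inj F j i eq)
  ... | no  off      = ⊥-elim (off (i , refl))

  posV-off : ∀ F {w} → (∀ i → vtx F i ≢ w) → posV M F w ≡ nothing
  posV-off F {w} off with any? (λ j → vtx F j Fin.≟ w)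
  ... | yes (j , eq) = ⊥-elim (off j eq)
  ... | no  _        = refl

  posE-at : ∀ F i → posE M F (edg F i) ≡ just i
  posE-at F i with any? (λ j → edg F j Fin.≟ edg F i)
  ... | yes (j , eq) = cong just (edg-inj F j i eq)
  ... | no  off      = ⊥-elim (off (i , refl))

  posE-off : ∀ F {x} → (∀ i → edg F i ≢ x) → posE M F x ≡ nothing
  posE-off F {x} off with any? (λ j → edg F j Fin.≟ x)
  ... | yes (j , eq) = ⊥-elim (off j eq)
  ... | no  _        = refl

  private
    two-faces : ∀ {x A B} → HasEdge A x → HasEdge B x → A ≢ B → ∀ {D} → HasEdge D x → D ≡ A ⊎ D ≡ B
    two-faces {x} (i , ai) (j , bj) A≢B (k , dk) with edge-faces x
    ... | F , G , _ , _ , _ , unique with unique _ i ai | unique _ j bj | unique _ k dk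
    ...   | inj₁ refl | inj₁ refl | _         = ⊥-elim (A≢B refl)
    ...   | inj₂ refl | inj₂ refl | _         = ⊥-elim (A≢B refl)
    ...   | inj₁ refl | inj₂ refl | inj₁ refl = inj₁ refl
    ...   | inj₁ refl | inj₂ refl | inj₂ refl = inj₂ refl
    ...   | inj₂ refl | inj₁ refl | inj₁ refl = inj₂ refl
    ...   | inj₂ refl | inj₁ refl | inj₂ refl = inj₁ refl

    searched : ∀ {F H x} → (not (isYes (H Fin.≟ F)) ∧ is-just (posE M H x)) ≡ true → H ≢ F × HasEdge H x
    searched {F} {H} {x} found with H Fin.≟ F | any? (λ k → edg H k Fin.≟ x)
    ... | no H≢F | yes has = H≢F , has

    searchable : ∀ {F H x} → H ≢ F → HasEdge H x → (not (isYes (H Fin.≟ F)) ∧ is-just (posE M H x)) ≡ true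
    searchable {F} {H} {x} H≢F (k , refl) with H Fin.≟ F
    ... | yes H≡F = ⊥-elim (H≢F H≡F)
    ... | no  _   rewrite posE-at H k = refl

  otherFace-spec : ∀ {F x} → HasEdge F x → otherFace M F x ≢ F × HasEdge (otherFace M F x) x
  otherFace-spec {F} {x} (i , Fi≡x)
    with any? (λ H → (not (isYes (H Fin.≟ F)) ∧ is-just (posE M H x)) Data.Bool.≟ true)
  ... | yes (H , found) = searched found
  ... | no  none with edge-faces x
  ...   | F₁ , F₂ , F₁≢F₂ , (i₁ , e₁) , (i₂ , e₂) , unique with unique F i Fi≡x
  ...     | inj₁ refl = ⊥-elim (none (F₂ , searchable (F₁≢F₂ ∘ sym) (i₂ , e₂)))
  ...     | inj₂ refl = ⊥-elim (none (F₁ , searchable F₁≢F₂ (i₁ , e₁)))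

  otherFace-≢ : ∀ {F x} → HasEdge F x → otherFace M F x ≢ F
  otherFace-≢ = proj₁ ∘ otherFace-spec

  otherFace-has : ∀ {F x} → HasEdge F x → HasEdge (otherFace M F x) x
  otherFace-has = proj₂ ∘ otherFace-spec

  faces-of-edge : ∀ {F x} → HasEdge F x → ∀ {D} → HasEdge D x → D ≡ F ⊎ D ≡ otherFace M F x
  faces-of-edge has = two-faces has (otherFace-has has) (otherFace-≢ has ∘ sym)

  otherFace-involutive : ∀ {F x} → HasEdge F x → otherFace M (otherFace M F x) x ≡ F
  otherFace-involutive has with faces-of-edge has (otherFace-has (otherFace-has has))
  ... | inj₁ eq = eq
  ... | inj₂ eq = ⊥-elim (otherFace-≢ (otherFace-has has) eq)

  across : (F : Fin nF) → Fin (size F) → Fin nF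
  across F i = G M F i

  across-≢ : ∀ F i → across F i ≢ F
  across-≢ F i = otherFace-≢ (i , refl)

  across-edge : ∀ F i → Σ (Fin (size (across F i))) λ j →
                edg (across F i) j ≡ edg F i × vtx F i ≡ vtx (across F i) (csuc j) × vtx F (csuc i) ≡ vtx (across F i) j
  across-edge F i with j , Gj≡Fi ← otherFace-has (i , refl)
    = j , Gj≡Fi , oriented F i (across F i) j (across-≢ F i ∘ sym) (sym Gj≡Fi)

  across-∋-start : ∀ F i → OnFace M (across F i) (vtx F i)
  across-∋-start F i with j , _ , start , _ ← across-edge F i = csuc j , sym start

  across-∋-end : ∀ F i → OnFace M (across F i) (vtx F (csuc i))
  across-∋-end F i with j , _ , _ , end ← across-edge F i = j , sym end

  EndsAt : Fin nF → Fin nE → Fin nV → Set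
  EndsAt T x w = Σ (Fin (size T)) λ j → edg T j ≡ x × vtx T (csuc j) ≡ w

  arrival : ∀ H k → EndsAt (across H k) (edg H k) (vtx H k)
  arrival H k with across-edge H k
  ... | j , Aj≡Hk , start , _ = j , Aj≡Hk , sym start

  -- Around a vertex w, the face H is followed by the face across the edge of H leaving w.
  turn : Fin nF → Fin nV → Fin nF
  turn H w with posV M H w
  ... | just k  = across H k
  ... | nothing = H

  turn-at : ∀ H k → turn H (vtx H k) ≡ across H k
  turn-at H k rewrite posV-at H k = refl

  module _ (v : Fin nV) where

    turn-closed : ∀ {H} → OnFace M H v → OnFace M (turn H v) v
    turn-closed {H} (k , refl) rewrite turn-at H k = across-∋-start H k

    turn-no-fix : ∀ {H} → OnFace M H v → turn H v ≢ H
    turn-no-fix {H} (k , refl) rewrite turn-at H k = across-≢ H k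

    turn-injective : ∀ {H H′} → OnFace M H v → OnFace M H′ v → turn H v ≡ turn H′ v → H ≡ H′
    turn-injective {H} {H′} (k , refl) (k′ , H′k′≡v) same =
      conclude (arrival H k) (subst (λ T → EndsAt T (edg H′ k′) (vtx H′ k′)) A′≡A (arrival H′ k′))
      where
      A : Fin nF
      A = across H k
      A′≡A : across H′ k′ ≡ A
      A′≡A = trans (sym (turn-at H′ k′)) (trans (cong (turn H′) H′k′≡v) (trans (sym same) (turn-at H k)))
      beyond-A : ∀ {D x} → HasEdge A x → D ≢ A → HasEdge D x → D ≡ otherFace M A x
      beyond-A A∋x D≢A D∋x with faces-of-edge A∋x D∋x
      ... | inj₁ D≡A = ⊥-elim (D≢A D≡A)
      ... | inj₂ D≡  = D≡
      conclude : EndsAt A (edg H k) (vtx H k) → EndsAt A (edg H′ k′) (vtx H′ k′) → H ≡ H′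
      conclude (j , Aj≡Hk , end) (j′ , Aj′≡H′k′ , end′) = trans
        (beyond-A (j , Aj≡Hk) (across-≢ H k ∘ sym) (k , refl))
        (sym (beyond-A (j , Aj≡Hk) (λ H′≡A → across-≢ H′ k′ (trans A′≡A (sym H′≡A))) (k′ , sym shared)))
        where
        shared : edg H k ≡ edg H′ k′
        shared = trans (sym Aj≡Hk) (trans (cong (edg A) (csuc-injective (vtx-inj A _ _ (trans end (trans (sym H′k′≡v) (sym end′))))))
                                          Aj′≡H′k′)

  module Around (v : Fin nV) =
    ThreeCycle (vertex-faces v) (λ H → turn H v) (turn-closed v) (turn-injective v) (turn-no-fix v)

  turn-across-end : ∀ F i → turn (across F i) (vtx F (csuc i)) ≡ F
  turn-across-end F i with j , Aj≡Fi , _ , end ← across-edge F i = begin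
    turn A (vtx F (csuc i))         ≡⟨ cong (turn A) end ⟩
    turn A (vtx A j)                ≡⟨ turn-at A j ⟩
    otherFace M A (edg A j)         ≡⟨ cong (otherFace M A) Aj≡Fi ⟩
    otherFace M A (edg F i)         ≡⟨ otherFace-involutive (i , refl) ⟩
    F                               ∎
    where
    open ≡-Reasoning
    A : Fin nF
    A = across F i

  module Corner (F : Fin nF) (i : Fin (size F)) where

    private
      v : Fin nV
      v = vtx F i
      F∋v : OnFace M F v
      F∋v = i , refl
      previous∋v : OnFace M (across F (cpred i)) v
      previous∋v with k , eq ← across-∋-end F (cpred i) = k , trans eq (cong (vtx F) (csuc-cpred i))

    turn-previous : turn (across F (cpred i)) v ≡ F
    turn-previous = trans (cong (λ j → turn (across F (cpred i)) (vtx F j)) (sym (csuc-cpred i)))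
                          (turn-across-end F (cpred i))

    turn-across-start : turn (across F i) v ≡ across F (cpred i)
    turn-across-start = turn-injective v
      (subst (λ H → OnFace M (turn H v) v) (turn-at F i) (turn-closed v (turn-closed v F∋v)))
      previous∋v
      (trans (cong (λ H → turn (turn H v) v) (sym (turn-at F i))) (trans (Around.f³≡id v F∋v) (sym turn-previous)))

    across-pred≢across : across F (cpred i) ≢ across F i
    across-pred≢across eq = turn-no-fix v (across-∋-start F i) (trans turn-across-start eq)

    faces-at-corner : ∀ {D} → OnFace M D v → D ≡ F ⊎ D ≡ across F (cpred i) ⊎ D ≡ across F i
    faces-at-corner D∋v = rename (Around.orbit v F∋v D∋v)
      where
      rename : ∀ {D} → D ≡ F ⊎ D ≡ turn F v ⊎ D ≡ turn (turn F v) v → D ≡ F ⊎ D ≡ across F (cpred i) ⊎ D ≡ across F i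
      rename (inj₁ D≡F)            = inj₁ D≡F
      rename (inj₂ (inj₁ D≡turn))  = inj₂ (inj₂ (trans D≡turn (turn-at F i)))
      rename (inj₂ (inj₂ D≡turn²)) = inj₂ (inj₁ (trans D≡turn² (trans (cong (λ H → turn H v) (turn-at F i)) turn-across-start)))

module VertexCoordinate (M : Map3) (Hy : IsOriented3ValentMap M) where

  open MapGeometry M Hy
  open Map3 M
  open IsOriented3ValentMap Hy

  ref : Fin nV → Fin nF
  ref v = proj₁ (vertex-faces v)

  ref∋ : ∀ v → OnFace M (ref v) v
  ref∋ v with _ , _ , _ , _ , _ , _ , ref∋v , _ ← vertex-faces v = ref∋v

  turns : Fin 3 → Fin nF → Fin nV → Fin nF
  turns zero             H w = H
  turns (suc zero)       H w = turn H w
  turns (suc (suc zero)) H w = turn (turn H w) w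

  classify : (H R T : Fin nF) → Fin 3
  classify H R T = if does (H Fin.≟ R) then zero else if does (H Fin.≟ T) then suc zero else suc (suc zero)

  classify-first : ∀ R T → classify R R T ≡ zero
  classify-first R T rewrite dec-true (R Fin.≟ R) refl = refl

  classify-second : ∀ {R T} → R ≢ T → classify T R T ≡ suc zero
  classify-second {R} {T} R≢T rewrite dec-false (T Fin.≟ R) (R≢T ∘ sym) | dec-true (T Fin.≟ T) refl = refl

  classify-third : ∀ {H R T} → H ≢ R → H ≢ T → classify H R T ≡ suc (suc zero)
  classify-third {H} {R} {T} H≢R H≢T rewrite dec-false (H Fin.≟ R) H≢R | dec-false (H Fin.≟ T) H≢T = refl

  coord : Fin nF → Fin nV → Fin 3
  coord H v = classify H (ref v) (turn (ref v) v)

  module _ (v : Fin nV) where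

    private
      R T T² : Fin nF
      R  = ref v
      T  = turn R v
      T² = turn T v
      T∋v : OnFace M T v
      T∋v = turn-closed v (ref∋ v)
      R≢T : R ≢ T
      R≢T = turn-no-fix v (ref∋ v) ∘ sym
      R≢T² : R ≢ T²
      R≢T² = Around.f²-no-fix v (ref∋ v) ∘ sym
      T≢T² : T ≢ T²
      T≢T² = turn-no-fix v T∋v ∘ sym

    coord-ref : coord R v ≡ zero
    coord-ref = classify-first R T

    coord-turn-ref : coord T v ≡ suc zero
    coord-turn-ref = classify-second R≢T

    coord-turn²-ref : coord T² v ≡ suc (suc zero)
    coord-turn²-ref = classify-third (R≢T² ∘ sym) (T≢T² ∘ sym)

    orbit-ref : ∀ {H} → OnFace M H v → H ≡ R ⊎ H ≡ T ⊎ H ≡ T²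
    orbit-ref = Around.orbit v (ref∋ v)

    coord-turn : ∀ {H} → OnFace M H v → coord (turn H v) v ≡ coord H v +₃ suc zero
    coord-turn H∋v = by-orbit (orbit-ref H∋v)
      where
      by-orbit : ∀ {H} → H ≡ R ⊎ H ≡ T ⊎ H ≡ T² → coord (turn H v) v ≡ coord H v +₃ suc zero
      by-orbit (inj₁ refl)        = trans coord-turn-ref (sym (cong (_+₃ suc zero) coord-ref))
      by-orbit (inj₂ (inj₁ refl)) = trans coord-turn²-ref (sym (cong (_+₃ suc zero) coord-turn-ref))
      by-orbit (inj₂ (inj₂ refl)) = trans (cong (λ H → coord H v) (Around.f³≡id v (ref∋ v)))
                                          (trans coord-ref (sym (cong (_+₃ suc zero) coord-turn²-ref)))

    turns-coord : ∀ {H} → OnFace M H v → turns (coord H v) R v ≡ H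
    turns-coord H∋v = by-orbit (orbit-ref H∋v)
      where
      by-orbit : ∀ {H} → H ≡ R ⊎ H ≡ T ⊎ H ≡ T² → turns (coord H v) R v ≡ H
      by-orbit (inj₁ refl)        = cong (λ t → turns t R v) coord-ref
      by-orbit (inj₂ (inj₁ refl)) = cong (λ t → turns t R v) coord-turn-ref
      by-orbit (inj₂ (inj₂ refl)) = cong (λ t → turns t R v) coord-turn²-ref

  +₃-identityʳ : ∀ a → a +₃ zero ≡ a
  +₃-identityʳ zero             = refl
  +₃-identityʳ (suc zero)       = refl
  +₃-identityʳ (suc (suc zero)) = refl

  +₃-1+1 : ∀ a → (a +₃ suc zero) +₃ suc zero ≡ a +₃ suc (suc zero)
  +₃-1+1 zero             = refl
  +₃-1+1 (suc zero)       = refl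
  +₃-1+1 (suc (suc zero)) = refl

  coord-turns : ∀ {H v} → OnFace M H v → ∀ t → coord (turns t H v) v ≡ coord H v +₃ t
  coord-turns H∋v zero             = sym (+₃-identityʳ _)
  coord-turns H∋v (suc zero)       = coord-turn _ H∋v
  coord-turns {H} {v} H∋v (suc (suc zero)) = begin
    coord (turn (turn H v) v) v                  ≡⟨ coord-turn v (turn-closed v H∋v) ⟩
    coord (turn H v) v +₃ suc zero               ≡⟨ cong (_+₃ suc zero) (coord-turn v H∋v) ⟩
    (coord H v +₃ suc zero) +₃ suc zero          ≡⟨ +₃-1+1 (coord H v) ⟩
    coord H v +₃ suc (suc zero)                  ∎
    where open ≡-Reasoning

  IsCorner : Cor M → Set
  IsCorner (H , w) = OnFace M H w

  turnC : Cor M → Cor M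
  turnC (H , w) = turn H w , w

  turnsC : Fin 3 → Cor M → Cor M
  turnsC t (H , w) = turns t H w , w

  coordC : Cor M → Fin 3
  coordC (H , w) = coord H w

  record Rotational (g : Cor M → Cor M) : Set where
    field
      corner↦corner : ∀ {c} → IsCorner c → IsCorner (g c)
      turn-commute  : ∀ {c} → IsCorner c → g (turnC c) ≡ turnC (g c)

  module _ {g : Cor M → Cor M} (rot : Rotational g) where
    open Rotational rot

    turns-commute : ∀ {c} → IsCorner c → ∀ t → g (turnsC t c) ≡ turnsC t (g c)
    turns-commute c-corner zero             = refl
    turns-commute c-corner (suc zero)       = turn-commute c-corner
    turns-commute c-corner (suc (suc zero)) =
      trans (turn-commute (turn-closed _ c-corner)) (cong turnC (turn-commute c-corner))

    rotational-at : ∀ {H w} → OnFace M H w → g (H , w) ≡ turnsC (coord H w) (g (ref w , w))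
    rotational-at {H} {w} H∋w = begin
      g (H , w)                                   ≡⟨ cong (λ H′ → g (H′ , w)) (turns-coord w H∋w) ⟨
      g (turnsC (coord H w) (ref w , w))          ≡⟨ turns-commute (ref∋ w) (coord H w) ⟩
      turnsC (coord H w) (g (ref w , w))          ∎
      where open ≡-Reasoning

    coordC-rotational : ∀ {H w} → OnFace M H w → coordC (g (H , w)) ≡ coordC (g (ref w , w)) +₃ coord H w
    coordC-rotational {H} {w} H∋w =
      trans (cong coordC (rotational-at H∋w)) (coord-turns (corner↦corner (ref∋ w)) (coord H w))

  coord-injective : ∀ {A B v} → OnFace M A v → OnFace M B v → coord A v ≡ coord B v → A ≡ B
  coord-injective {A} {B} {v} A∋v B∋v same =
    trans (sym (turns-coord v A∋v)) (trans (cong (λ t → turns t (ref v) v) same) (turns-coord v B∋v))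

module SideMovement (M : Map3) (Hy : IsOriented3ValentMap M) where

  open Cycle
  open MapGeometry M Hy
  open VertexCoordinate M Hy
  open Map3 M
  open IsOriented3ValentMap Hy

  IsSide : Side M → Set
  IsSide (H , x) = HasEdge H x

  otherSide : Side M → Side M
  otherSide (H , x) = otherFace M H x , x

  module _ (F : Fin nF) where

    smCor-off : ∀ {H w} → (∀ i → vtx F i ≢ w) → smCor M F (H , w) ≡ (H , w)
    smCor-off {H} {w} off rewrite posV-off F off = refl

    smCor-face : ∀ i → smCor M F (F , vtx F i) ≡ (F , vtx F (csuc i))
    smCor-face i rewrite posV-at F i with F Fin.≟ F
    ... | yes _  = refl
    ... | no F≢F = ⊥-elim (F≢F refl)

    smCor-previous : ∀ i → smCor M F (across F (cpred i) , vtx F i) ≡ (across F i , vtx F (csuc i))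
    smCor-previous i rewrite posV-at F i with across F (cpred i) Fin.≟ F
    ... | yes eq = ⊥-elim (across-≢ F (cpred i) eq)
    ... | no _ with across F (cpred i) Fin.≟ across F (cpred i)
    ...   | yes _  = refl
    ...   | no A≢A = ⊥-elim (A≢A refl)

    smCor-next : ∀ i → smCor M F (across F i , vtx F i) ≡ (across F (csuc i) , vtx F (csuc i))
    smCor-next i rewrite posV-at F i with across F i Fin.≟ F
    ... | yes eq = ⊥-elim (across-≢ F i eq)
    ... | no _ with across F i Fin.≟ across F (cpred i)
    ...   | yes eq = ⊥-elim (Corner.across-pred≢across F i (sym eq))
    ...   | no _ with across F i Fin.≟ across F i
    ...     | yes _  = refl
    ...     | no A≢A = ⊥-elim (A≢A refl)

    smSide-off : ∀ {H x} → (∀ i → edg F i ≢ x) → smSide M F (H , x) ≡ (H , x)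
    smSide-off {H} {x} off rewrite posE-off F off = refl

    smSide-face : ∀ i → smSide M F (F , edg F i) ≡ (F , edg F (csuc i))
    smSide-face i rewrite posE-at F i with F Fin.≟ F
    ... | yes _  = refl
    ... | no F≢F = ⊥-elim (F≢F refl)

    smSide-across : ∀ i → smSide M F (across F i , edg F i) ≡ (across F (csuc i) , edg F (csuc i))
    smSide-across i rewrite posE-at F i with across F i Fin.≟ F
    ... | yes eq = ⊥-elim (across-≢ F i eq)
    ... | no _ with across F i Fin.≟ across F i
    ...   | yes _  = refl
    ...   | no A≢A = ⊥-elim (A≢A refl)

    private
      ρ : Permutation′ nV
      ρ = cycle (vtx F) (vtx-injective F)
      Lands : Cor M → Cor M → Set
      Lands c d = IsCorner d × proj₂ d ≡ ρ ⟨$⟩ʳ proj₂ c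
      via : ∀ {c d} → smCor M F c ≡ d → Lands c d → Lands c (smCor M F c)
      via {c} eq = subst (Lands c) (sym eq)

    smCor-corner : ∀ {c} → IsCorner c → IsCorner (smCor M F c) × proj₂ (smCor M F c) ≡ ρ ⟨$⟩ʳ proj₂ c
    smCor-corner {H , w} H∋w with onSequence? (vtx F) w
    ... | inj₂ off = via (smCor-off off) (H∋w , sym (cycle-off (vtx F) (vtx-injective F) off))
    ... | inj₁ (i , refl) = by-face (Corner.faces-at-corner F i H∋w)
      where
      moved : vtx F (csuc i) ≡ ρ ⟨$⟩ʳ vtx F i
      moved = sym (cycle-on (vtx F) (vtx-injective F) i)
      by-face : ∀ {H} → H ≡ F ⊎ H ≡ across F (cpred i) ⊎ H ≡ across F i → Lands (H , vtx F i) (smCor M F (H , vtx F i))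
      by-face (inj₁ refl)        = via (smCor-face i)     ((csuc i , refl) , moved)
      by-face (inj₂ (inj₁ refl)) = via (smCor-previous i) (across-∋-end F i , moved)
      by-face (inj₂ (inj₂ refl)) = via (smCor-next i)     (across-∋-start F (csuc i) , moved)

    smCor-turn : ∀ {c} → IsCorner c → smCor M F (turnC c) ≡ turnC (smCor M F c)
    smCor-turn {H , w} H∋w with onSequence? (vtx F) w
    ... | inj₂ off = trans (smCor-off off) (cong turnC (sym (smCor-off off)))
    ... | inj₁ (i , refl) = by-face (Corner.faces-at-corner F i H∋w)
      where
      v v′ : Fin nV
      v  = vtx F i
      v′ = vtx F (csuc i)
      by-face : ∀ {H} → H ≡ F ⊎ H ≡ across F (cpred i) ⊎ H ≡ across F i →
                smCor M F (turn H v , v) ≡ turnC (smCor M F (H , v))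
      by-face (inj₁ refl) = begin
        smCor M F (turn F v , v)                 ≡⟨ cong (λ H → smCor M F (H , v)) (turn-at F i) ⟩
        smCor M F (across F i , v)               ≡⟨ smCor-next i ⟩
        (across F (csuc i) , v′)                 ≡⟨ cong (_, v′) (turn-at F (csuc i)) ⟨
        turnC (F , v′)                           ≡⟨ cong turnC (smCor-face i) ⟨
        turnC (smCor M F (F , v))                ∎
        where open ≡-Reasoning
      by-face (inj₂ (inj₁ refl)) = begin
        smCor M F (turn (across F (cpred i)) v , v)   ≡⟨ cong (λ H → smCor M F (H , v)) (Corner.turn-previous F i) ⟩
        smCor M F (F , v)                             ≡⟨ smCor-face i ⟩
        (F , v′)                                      ≡⟨ cong (_, v′) (turn-across-end F i) ⟨
        turnC (across F i , v′)                       ≡⟨ cong turnC (smCor-previous i) ⟨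
        turnC (smCor M F (across F (cpred i) , v))    ∎
        where open ≡-Reasoning
      by-face (inj₂ (inj₂ refl)) = begin
        smCor M F (turn (across F i) v , v)           ≡⟨ cong (λ H → smCor M F (H , v)) (Corner.turn-across-start F i) ⟩
        smCor M F (across F (cpred i) , v)            ≡⟨ smCor-previous i ⟩
        (across F i , v′)                             ≡⟨ cong (λ j → across F j , v′) (cpred-csuc i) ⟨
        (across F (cpred (csuc i)) , v′)              ≡⟨ cong (_, v′) (Corner.turn-across-start F (csuc i)) ⟨
        turnC (across F (csuc i) , v′)                ≡⟨ cong turnC (smCor-next i) ⟨
        turnC (smCor M F (across F i , v))            ∎
        where open ≡-Reasoning

    private
      ε : Permutation′ nE
      ε = cycle (edg F) (edg-injective F)
      SideLands : Side M → Side M → Set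
      SideLands c d = IsSide d × proj₂ d ≡ ε ⟨$⟩ʳ proj₂ c
      via-side : ∀ {c d} → smSide M F c ≡ d → SideLands c d → SideLands c (smSide M F c)
      via-side {c} eq = subst (SideLands c) (sym eq)

    smSide-side : ∀ {c} → IsSide c → IsSide (smSide M F c) × proj₂ (smSide M F c) ≡ ε ⟨$⟩ʳ proj₂ c
    smSide-side {H , x} H∋x with onSequence? (edg F) x
    ... | inj₂ off = via-side (smSide-off off) (H∋x , sym (cycle-off (edg F) (edg-injective F) off))
    ... | inj₁ (i , refl) = by-face (faces-of-edge (i , refl) H∋x)
      where
      moved : edg F (csuc i) ≡ ε ⟨$⟩ʳ edg F i
      moved = sym (cycle-on (edg F) (edg-injective F) i)
      by-face : ∀ {H} → H ≡ F ⊎ H ≡ across F i → SideLands (H , edg F i) (smSide M F (H , edg F i))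
      by-face (inj₁ refl) = via-side (smSide-face i)   ((csuc i , refl) , moved)
      by-face (inj₂ refl) = via-side (smSide-across i) (otherFace-has (csuc i , refl) , moved)

    smSide-other : ∀ {c} → IsSide c → smSide M F (otherSide c) ≡ otherSide (smSide M F c)
    smSide-other {H , x} H∋x with onSequence? (edg F) x
    ... | inj₂ off = trans (smSide-off off) (cong otherSide (sym (smSide-off off)))
    ... | inj₁ (i , refl) = by-face (faces-of-edge (i , refl) H∋x)
      where
      by-face : ∀ {H} → H ≡ F ⊎ H ≡ across F i → smSide M F (otherSide (H , edg F i)) ≡ otherSide (smSide M F (H , edg F i))
      by-face (inj₁ refl) = trans (smSide-across i) (cong otherSide (sym (smSide-face i)))
      by-face (inj₂ refl) = begin
        smSide M F (otherFace M (across F i) (edg F i) , edg F i)   ≡⟨ cong (λ H → smSide M F (H , edg F i)) (otherFace-involutive (i , refl)) ⟩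
        smSide M F (F , edg F i)                                    ≡⟨ smSide-face i ⟩
        (F , edg F (csuc i))                                        ≡⟨ cong (_, edg F (csuc i)) (otherFace-involutive (csuc i , refl)) ⟨
        otherSide (across F (csuc i) , edg F (csuc i))              ≡⟨ cong otherSide (smSide-across i) ⟨
        otherSide (smSide M F (across F i , edg F i))               ∎
        where open ≡-Reasoning

module Legality (M : Map3) (Hy : IsOriented3ValentMap M) where

  open FiniteSum
  open InversionParity
  open Cycle
  open MapGeometry M Hy
  open VertexCoordinate M Hy
  open SideMovement M Hy
  open Map3 M
  open IsOriented3ValentMap Hy

  refFace : Fin nE → Fin nF
  refFace x = proj₁ (edge-faces x)

  refFace∋ : ∀ x → HasEdge (refFace x) x
  refFace∋ x with _ , _ , _ , refFace∋x , _ ← edge-faces x = refFace∋x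

  flipped : Side M → Bool
  flipped (H , x) = not (does (H Fin.≟ refFace x))

  flip : Elt M → Fin nE → Bool
  flip g x = flipped (proj₂ g (refFace x , x))

  twist : Elt M → Fin nV → Fin 3
  twist g v = coordC (proj₁ g (ref v , v))

  flipped-ref : ∀ x → flipped (refFace x , x) ≡ false
  flipped-ref x rewrite dec-true (refFace x Fin.≟ refFace x) refl = refl

  flipped-other : ∀ x → flipped (otherFace M (refFace x) x , x) ≡ true
  flipped-other x rewrite dec-false (otherFace M (refFace x) x Fin.≟ refFace x) (otherFace-≢ (refFace∋ x)) = refl

  flipped-otherSide : ∀ {c} → IsSide c → flipped (otherSide c) ≡ not (flipped c)
  flipped-otherSide {B , z} B∋z with faces-of-edge (refFace∋ z) B∋z
  ... | inj₁ refl = trans (flipped-other z) (cong not (sym (flipped-ref z)))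
  ... | inj₂ refl = trans (cong (λ H → flipped (H , z)) (otherFace-involutive (refFace∋ z)))
                          (trans (flipped-ref z) (cong not (sym (flipped-other z))))

  -- The invariants of side movements that survive composition, hence hold on all of Rubik(M).
  record Legal (g : Elt M) : Set where
    field
      vertexPerm            : Permutation′ nV
      edgePerm              : Permutation′ nE
      corner↦corner         : ∀ {c} → IsCorner c → IsCorner (proj₁ g c)
      vertex-action         : ∀ {c} → IsCorner c → proj₂ (proj₁ g c) ≡ vertexPerm ⟨$⟩ʳ proj₂ c
      side↦side             : ∀ {c} → IsSide c → IsSide (proj₂ g c)
      edge-action           : ∀ {c} → IsSide c → proj₂ (proj₂ g c) ≡ edgePerm ⟨$⟩ʳ proj₂ c
      turn-commute          : ∀ {c} → IsCorner c → proj₁ g (turnC c) ≡ turnC (proj₁ g c)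
      other-commute         : ∀ {c} → IsSide c → proj₂ g (otherSide c) ≡ otherSide (proj₂ g c)
      parity-vertices≡edges : parity vertexPerm ≡ parity edgePerm
      odd-faces⇒even        : (∀ F → size F % 2 ≡ 1) → parity vertexPerm ≡ 0
      flips-even            : (∑[ x < nE ] 𝟙 (flip g x)) % 2 ≡ 0
      twists-zero           : (∑[ v < nV ] toℕ (twist g v)) % 3 ≡ 0

    rotational : Rotational (proj₁ g)
    rotational = record { corner↦corner = corner↦corner ; turn-commute = turn-commute }

  open Legal

  module _ {g : Elt M} (legal : Legal g) where

    flipped-move : ∀ {c} → IsSide c → flipped (proj₂ g c) ≡ flipped c xor flip g (proj₂ c)
    flipped-move {A , y} A∋y with faces-of-edge (refFace∋ y) A∋y
    ... | inj₁ refl rewrite flipped-ref y = refl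
    ... | inj₂ refl = begin
      flipped (proj₂ g (otherSide (refFace y , y)))   ≡⟨ cong flipped (other-commute legal (refFace∋ y)) ⟩
      flipped (otherSide (proj₂ g (refFace y , y)))   ≡⟨ flipped-otherSide (side↦side legal (refFace∋ y)) ⟩
      not (flip g y)                                  ≡⟨ cong (_xor flip g y) (flipped-other y) ⟨
      flipped (otherSide (refFace y , y)) xor flip g y ∎
      where open ≡-Reasoning

  module _ {g h : Elt M} (legal-g : Legal g) (legal-h : Legal h) where

    flip-∙ : ∀ x → flip (_·_ M g h) x ≡ flip h x xor flip g (edgePerm legal-h ⟨$⟩ʳ x)
    flip-∙ x = trans (flipped-move legal-g (side↦side legal-h (refFace∋ x)))
                     (cong (λ y → flip h x xor flip g y) (edge-action legal-h (refFace∋ x)))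

    twist-∙ : ∀ v → twist (_·_ M g h) v ≡ twist g (vertexPerm legal-h ⟨$⟩ʳ v) +₃ twist h v
    twist-∙ v = trans (coordC-rotational (rotational legal-g) (corner↦corner legal-h (ref∋ v)))
                      (cong (λ u → twist g u +₃ twist h v) (vertex-action legal-h (ref∋ v)))

  𝟙-xor : ∀ a b → 𝟙 (a xor b) % 2 ≡ (𝟙 a + 𝟙 b) % 2
  𝟙-xor false false = refl
  𝟙-xor false true  = refl
  𝟙-xor true  false = refl
  𝟙-xor true  true  = refl

  toℕ-+₃ : ∀ a b → toℕ (a +₃ b) % 3 ≡ (toℕ b + toℕ a) % 3
  toℕ-+₃ zero             zero             = refl
  toℕ-+₃ zero             (suc zero)       = refl
  toℕ-+₃ zero             (suc (suc zero)) = refl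
  toℕ-+₃ (suc zero)       zero             = refl
  toℕ-+₃ (suc zero)       (suc zero)       = refl
  toℕ-+₃ (suc zero)       (suc (suc zero)) = refl
  toℕ-+₃ (suc (suc zero)) zero             = refl
  toℕ-+₃ (suc (suc zero)) (suc zero)       = refl
  toℕ-+₃ (suc (suc zero)) (suc (suc zero)) = refl

  Legal-∙ : ∀ {g h} → Legal g → Legal h → Legal (_·_ M g h)
  Legal-∙ {g} {h} legal-g legal-h = record
    { vertexPerm            = vertexPerm legal-h ∘ₚ vertexPerm legal-g
    ; edgePerm              = edgePerm legal-h ∘ₚ edgePerm legal-g
    ; corner↦corner         = corner↦corner legal-g ∘ corner↦corner legal-h
    ; vertex-action         = λ c → trans (vertex-action legal-g (corner↦corner legal-h c))
                                          (cong (vertexPerm legal-g ⟨$⟩ʳ_) (vertex-action legal-h c))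
    ; side↦side             = side↦side legal-g ∘ side↦side legal-h
    ; edge-action           = λ c → trans (edge-action legal-g (side↦side legal-h c))
                                          (cong (edgePerm legal-g ⟨$⟩ʳ_) (edge-action legal-h c))
    ; turn-commute          = λ c → trans (cong (proj₁ g) (turn-commute legal-h c))
                                          (turn-commute legal-g (corner↦corner legal-h c))
    ; other-commute         = λ c → trans (cong (proj₂ g) (other-commute legal-h c))
                                          (other-commute legal-g (side↦side legal-h c))
    ; parity-vertices≡edges = trans (parity-∘ₚ (vertexPerm legal-h) (vertexPerm legal-g))
                                    (trans (cong₂ (λ a b → (a + b) % 2) (parity-vertices≡edges legal-g) (parity-vertices≡edges legal-h))
                                           (sym (parity-∘ₚ (edgePerm legal-h) (edgePerm legal-g))))
    ; odd-faces⇒even        = λ odd → trans (parity-∘ₚ (vertexPerm legal-h) (vertexPerm legal-g))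
                                            (cong₂ (λ a b → (a + b) % 2) (odd-faces⇒even legal-g odd) (odd-faces⇒even legal-h odd))
    ; flips-even            = ∑-cocycle nE 1 (edgePerm legal-h) _ (𝟙 ∘ flip h) (𝟙 ∘ flip g)
                                (λ x → trans (cong (λ b → 𝟙 b % 2) (flip-∙ legal-g legal-h x)) (𝟙-xor (flip h x) (flip g (edgePerm legal-h ⟨$⟩ʳ x))))
                                (flips-even legal-h) (flips-even legal-g)
    ; twists-zero           = ∑-cocycle nV 2 (vertexPerm legal-h) _ (toℕ ∘ twist h) (toℕ ∘ twist g)
                                (λ v → trans (cong (λ t → toℕ t % 3) (twist-∙ legal-g legal-h v)) (toℕ-+₃ (twist g (vertexPerm legal-h ⟨$⟩ʳ v)) (twist h v)))
                                (twists-zero legal-h) (twists-zero legal-g)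
    }

  Legal-id : Legal (idElt M)
  Legal-id = record
    { vertexPerm            = idₚ
    ; edgePerm              = idₚ
    ; corner↦corner         = λ c → c
    ; vertex-action         = λ _ → refl
    ; side↦side             = λ c → c
    ; edge-action           = λ _ → refl
    ; turn-commute          = λ _ → refl
    ; other-commute         = λ _ → refl
    ; parity-vertices≡edges = trans (parity-id {nV}) (sym (parity-id {nE}))
    ; odd-faces⇒even        = λ _ → parity-id {nV}
    ; flips-even            = cong (_% 2) (∑-zero nE λ x → cong 𝟙 (flipped-ref x))
    ; twists-zero           = cong (_% 3) (∑-zero nV λ v → cong toℕ (coord-ref v))
    }

  odd⇒pred-even : ∀ p → p % 2 ≡ 1 → (p ∸ 1) % 2 ≡ 0
  odd⇒pred-even (suc q) odd = %-cancel-suc {q} {0} 1 odd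

  module Generator (F : Fin nF) where

    private
      sm-rotational : Rotational (smCor M F)
      sm-rotational = record { corner↦corner = proj₁ ∘ smCor-corner F ; turn-commute = smCor-turn F }

      onF : Fin (size F) → Bool
      onF i = does (F Fin.≟ refFace (edg F i))

      complementary : ∀ {A B r : Fin nF} → A ≢ B → r ≡ A ⊎ r ≡ B → not (does (B Fin.≟ r)) ≡ does (A Fin.≟ r)
      complementary {A} {B} A≢B (inj₁ refl) rewrite dec-false (B Fin.≟ A) (A≢B ∘ sym) | dec-true (A Fin.≟ A) refl = refl
      complementary {A} {B} A≢B (inj₂ refl) rewrite dec-true (B Fin.≟ B) refl | dec-false (A Fin.≟ B) A≢B = refl

    flip-sm-off : ∀ {x} → (∀ i → edg F i ≢ x) → flip (sm M F) x ≡ false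
    flip-sm-off {x} off = trans (cong flipped (smSide-off F off)) (flipped-ref x)

    flip-sm-on : ∀ i → flip (sm M F) (edg F i) ≡ onF i xor onF (csuc i)
    flip-sm-on i = by-face (faces-of-edge (i , refl) (refFace∋ (edg F i)))
      where
      x x′ : Fin nE
      x  = edg F i
      x′ = edg F (csuc i)
      by-face : refFace x ≡ F ⊎ refFace x ≡ across F i → flip (sm M F) x ≡ onF i xor onF (csuc i)
      by-face (inj₁ r≡F) = begin
        flipped (smSide M F (refFace x , x))    ≡⟨ cong (λ H → flipped (smSide M F (H , x))) r≡F ⟩
        flipped (smSide M F (F , x))            ≡⟨ cong flipped (smSide-face F i) ⟩
        not (onF (csuc i))                      ≡⟨ cong (_xor onF (csuc i)) (dec-true (F Fin.≟ refFace x) (sym r≡F)) ⟨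
        onF i xor onF (csuc i)                  ∎
        where open ≡-Reasoning
      by-face (inj₂ r≡G) = begin
        flipped (smSide M F (refFace x , x))    ≡⟨ cong (λ H → flipped (smSide M F (H , x))) r≡G ⟩
        flipped (smSide M F (across F i , x))   ≡⟨ cong flipped (smSide-across F i) ⟩
        flipped (across F (csuc i) , x′)        ≡⟨ complementary (across-≢ F (csuc i) ∘ sym) (faces-of-edge (csuc i , refl) (refFace∋ x′)) ⟩
        onF (csuc i)                            ≡⟨ cong (_xor onF (csuc i)) (dec-false (F Fin.≟ refFace x) (λ F≡r → across-≢ F i (trans (sym r≡G) (sym F≡r)))) ⟨
        onF i xor onF (csuc i)                  ∎
        where open ≡-Reasoning

    twist-sm-off : ∀ {w} → (∀ i → vtx F i ≢ w) → twist (sm M F) w ≡ zero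
    twist-sm-off {w} off = trans (cong coordC (smCor-off F off)) (coord-ref w)

    coord-sm-step : ∀ i → coord F (vtx F (csuc i)) ≡ twist (sm M F) (vtx F i) +₃ coord F (vtx F i)
    coord-sm-step i = trans (cong coordC (sym (smCor-face F i))) (coordC-rotational sm-rotational (i , refl))

    flips-sm-even : (∑[ x < nE ] 𝟙 (flip (sm M F) x)) % 2 ≡ 0
    flips-sm-even = begin
      (∑[ x < nE ] 𝟙 (flip (sm M F) x)) % 2              ≡⟨ cong (_% 2) (∑-reindex (size F) nE (edg F) (edg-injective F) _ on-face) ⟨
      (∑[ i < size F ] 𝟙 (flip (sm M F) (edg F i))) % 2  ≡⟨ ∑-telescope (size F) 1 (𝟙 ∘ onF) _ telescoping-step ⟩
      0                                                  ∎
      where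
      open ≡-Reasoning
      on-face : ∀ x → 𝟙 (flip (sm M F) x) ≢ 0 → ∃ λ i → edg F i ≡ x
      on-face x flip≢0 with onSequence? (edg F) x
      ... | inj₁ found = found
      ... | inj₂ off   = ⊥-elim (flip≢0 (cong 𝟙 (flip-sm-off off)))
      xor-step : ∀ a b → (𝟙 a + 𝟙 (a xor b)) % 2 ≡ 𝟙 b % 2
      xor-step false false = refl
      xor-step false true  = refl
      xor-step true  false = refl
      xor-step true  true  = refl
      telescoping-step : ∀ i → (𝟙 (onF i) + 𝟙 (flip (sm M F) (edg F i))) % 2 ≡ 𝟙 (onF (csuc i)) % 2
      telescoping-step i = trans (cong (λ b → (𝟙 (onF i) + 𝟙 b) % 2) (flip-sm-on i)) (xor-step (onF i) (onF (csuc i)))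

    twists-sm-zero : (∑[ v < nV ] toℕ (twist (sm M F) v)) % 3 ≡ 0
    twists-sm-zero = begin
      (∑[ v < nV ] toℕ (twist (sm M F) v)) % 3              ≡⟨ cong (_% 3) (∑-reindex (size F) nV (vtx F) (vtx-injective F) _ on-face) ⟨
      (∑[ i < size F ] toℕ (twist (sm M F) (vtx F i))) % 3  ≡⟨ ∑-telescope (size F) 2 (λ i → toℕ (coord F (vtx F i))) _ telescoping-step ⟩
      0                                                     ∎
      where
      open ≡-Reasoning
      on-face : ∀ v → toℕ (twist (sm M F) v) ≢ 0 → ∃ λ i → vtx F i ≡ v
      on-face v twist≢0 with onSequence? (vtx F) v
      ... | inj₁ found = found
      ... | inj₂ off   = ⊥-elim (twist≢0 (cong toℕ (twist-sm-off off)))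
      telescoping-step : ∀ i → (toℕ (coord F (vtx F i)) + toℕ (twist (sm M F) (vtx F i))) % 3 ≡ toℕ (coord F (vtx F (csuc i))) % 3
      telescoping-step i = sym (trans (cong (λ t → toℕ t % 3) (coord-sm-step i)) (toℕ-+₃ (twist (sm M F) (vtx F i)) (coord F (vtx F i))))

    Legal-sm : Legal (sm M F)
    Legal-sm = record
      { vertexPerm            = cycle (vtx F) (vtx-injective F)
      ; edgePerm              = cycle (edg F) (edg-injective F)
      ; corner↦corner         = proj₁ ∘ smCor-corner F
      ; vertex-action         = proj₂ ∘ smCor-corner F
      ; side↦side             = proj₁ ∘ smSide-side F
      ; edge-action           = proj₂ ∘ smSide-side F
      ; turn-commute          = smCor-turn F
      ; other-commute         = smSide-other F
      ; parity-vertices≡edges = trans (parity-cycle (vtx F) (vtx-injective F)) (sym (parity-cycle (edg F) (edg-injective F)))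
      ; odd-faces⇒even        = λ odd → trans (parity-cycle (vtx F) (vtx-injective F)) (odd⇒pred-even (size F) (odd F))
      ; flips-even            = flips-sm-even
      ; twists-zero           = twists-sm-zero
      }

  Legal-rubik : ∀ {g} → InRubik M g → Legal g
  Legal-rubik rid            = Legal-id
  Legal-rubik (rstep F in-g) = Legal-∙ (Generator.Legal-sm F) (Legal-rubik in-g)

module Kernels (M : Map3) (Hy : IsOriented3ValentMap M) where

  open FiniteSum
  open InversionParity
  open MapGeometry M Hy
  open VertexCoordinate M Hy
  open SideMovement M Hy
  open Legality M Hy
  open Map3 M
  open IsOriented3ValentMap Hy
  open Legal

  module _ {g : Elt M} (legal : Legal g) where

    fixes-vertices : FixVertices M g → ∀ w → vertexPerm legal ⟨$⟩ʳ w ≡ w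
    fixes-vertices fixed w = trans (sym (vertex-action legal (ref∋ w))) (at-corner (ref∋ w))
      where
      at-corner : ∀ {c} → IsCorner c → proj₂ (proj₁ g c) ≡ proj₂ c
      at-corner {H , _} (k , refl) = fixed H k

    fixes-edges : FixEdges M g → ∀ x → edgePerm legal ⟨$⟩ʳ x ≡ x
    fixes-edges fixed x = trans (sym (edge-action legal (refFace∋ x))) (at-side (refFace∋ x))
      where
      at-side : ∀ {c} → IsSide c → proj₂ (proj₂ g c) ≡ proj₂ c
      at-side {H , _} (k , refl) = fixed H k

  part-iv : Part-iv M
  part-iv g in-g = vertexPerm legal ⟨$⟩ʳ_ , (λ _ _ → ⟨$⟩ʳ-injective (vertexPerm legal)) , (λ F i → vertex-action legal (i , refl)) ,
                   λ odd → (λ _ _ → ⟨$⟩ʳ-injective (vertexPerm legal)) , odd-faces⇒even legal odd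
    where
    legal : Legal g
    legal = Legal-rubik in-g

  part-ii : Part-ii M
  part-ii g in-g fixed = edgePerm legal ⟨$⟩ʳ_ , ((λ _ _ → ⟨$⟩ʳ-injective (edgePerm legal)) , even) , (λ F i → edge-action legal (i , refl))
    where
    legal : Legal g
    legal = Legal-rubik in-g
    even : parity (edgePerm legal) ≡ 0
    even = trans (sym (parity-vertices≡edges legal))
                 (trans (parity-cong {π = vertexPerm legal} {ρ = idₚ} (fixes-vertices legal (λ F i → cong proj₂ (fixed F i))))
                        (parity-id {nV}))

  flipped-injective : ∀ {A B x} → HasEdge A x → HasEdge B x → flipped (A , x) ≡ flipped (B , x) → A ≡ B
  flipped-injective {x = x} A∋x B∋x same with faces-of-edge (refFace∋ x) A∋x | faces-of-edge (refFace∋ x) B∋x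
  ... | inj₁ refl | inj₁ refl = refl
  ... | inj₂ refl | inj₂ refl = refl
  ... | inj₁ refl | inj₂ refl with () ← trans (sym (flipped-ref x)) (trans same (flipped-other x))
  ... | inj₂ refl | inj₁ refl with () ← trans (sym (flipped-other x)) (trans same (flipped-ref x))

  module _ {g h : Elt M} (legal-g : Legal g) (legal-h : Legal h) (fixed-g : FixEdges M g) (fixed-h : FixEdges M h) where

    ref-side-determined : (∀ x → flip g x ≡ flip h x) → ∀ x → proj₂ g (refFace x , x) ≡ proj₂ h (refFace x , x)
    ref-side-determined same-flip x = cong₂ _,_
      (flipped-injective (subst (HasEdge A) edge-g (side↦side legal-g (refFace∋ x)))
                         (subst (HasEdge B) edge-h (side↦side legal-h (refFace∋ x)))
                         (trans (cong (λ y → flipped (A , y)) (sym edge-g)) (trans (same-flip x) (cong (λ y → flipped (B , y)) edge-h))))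
      (trans edge-g (sym edge-h))
      where
      A B : Fin nF
      A = proj₁ (proj₂ g (refFace x , x))
      B = proj₁ (proj₂ h (refFace x , x))
      edge-g : proj₂ (proj₂ g (refFace x , x)) ≡ x
      edge-g = trans (edge-action legal-g (refFace∋ x)) (fixes-edges legal-g fixed-g x)
      edge-h : proj₂ (proj₂ h (refFace x , x)) ≡ x
      edge-h = trans (edge-action legal-h (refFace∋ x)) (fixes-edges legal-h fixed-h x)

    sides-determined : (∀ x → flip g x ≡ flip h x) → ∀ {c} → IsSide c → proj₂ g c ≡ proj₂ h c
    sides-determined same-flip {H , x} H∋x with faces-of-edge (refFace∋ x) H∋x
    ... | inj₁ refl = ref-side-determined same-flip x
    ... | inj₂ refl = begin
      proj₂ g (otherSide (refFace x , x))   ≡⟨ other-commute legal-g (refFace∋ x) ⟩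
      otherSide (proj₂ g (refFace x , x))   ≡⟨ cong otherSide (ref-side-determined same-flip x) ⟩
      otherSide (proj₂ h (refFace x , x))   ≡⟨ other-commute legal-h (refFace∋ x) ⟨
      proj₂ h (otherSide (refFace x , x))   ∎
      where open ≡-Reasoning

  part-i : Part-i M
  part-i = φ , well-defined , homomorphic , injective
    where
    φ : Elt M → Fin (nE ∸ 1) → Bool
    φ g k = flip g (embed k)
    well-defined : ∀ g h → InH₁ M g → InH₁ M h → _≈_ M g h → ∀ k → φ g k ≡ φ h k
    well-defined g h _ _ (_ , g≈h) k = cong flipped (same-side (refFace∋ (embed k)))
      where
      same-side : ∀ {c} → IsSide c → proj₂ g c ≡ proj₂ h c
      same-side {H , _} (i , refl) = g≈h H i
    homomorphic : ∀ g h → InH₁ M g → InH₁ M h → ∀ k → φ (_·_ M g h) k ≡ (φ g k xor φ h k)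
    homomorphic g h (in-g , _) (in-h , _ , fixed-h) k = begin
      flip (_·_ M g h) x                     ≡⟨ flip-∙ legal-g legal-h x ⟩
      flip h x xor flip g (edgePerm legal-h ⟨$⟩ʳ x) ≡⟨ cong (λ y → flip h x xor flip g y) (fixes-edges legal-h fixed-h x) ⟩
      flip h x xor flip g x                  ≡⟨ xor-comm (flip h x) (flip g x) ⟩
      flip g x xor flip h x                  ∎
      where
      open ≡-Reasoning
      x : Fin nE
      x = embed k
      legal-g : Legal g
      legal-g = Legal-rubik in-g
      legal-h : Legal h
      legal-h = Legal-rubik in-h
    injective : ∀ g h → InH₁ M g → InH₁ M h → (∀ k → φ g k ≡ φ h k) → _≈_ M g h
    injective g h (in-g , corners-g , edges-g) (in-h , corners-h , edges-h) same =
      (λ F i → trans (corners-g F i) (sym (corners-h F i))) ,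
      (λ F i → sides-determined legal-g legal-h edges-g edges-h all-flips (i , refl))
      where
      legal-g : Legal g
      legal-g = Legal-rubik in-g
      legal-h : Legal h
      legal-h = Legal-rubik in-h
      all-flips : ∀ x → flip g x ≡ flip h x
      all-flips = init-determines 1 𝟙 𝟙<2 𝟙-injective nE (flip g) (flip h)
                    (trans (flips-even legal-g) (sym (flips-even legal-h))) same

  module _ {g h : Elt M} (legal-g : Legal g) (legal-h : Legal h) (fixed-g : FixVertices M g) (fixed-h : FixVertices M h) where

    ref-corner-determined : (∀ v → twist g v ≡ twist h v) → ∀ v → proj₁ g (ref v , v) ≡ proj₁ h (ref v , v)
    ref-corner-determined same-twist v = cong₂ _,_
      (coord-injective (subst (OnFace M A) vertex-g (corner↦corner legal-g (ref∋ v)))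
                       (subst (OnFace M B) vertex-h (corner↦corner legal-h (ref∋ v)))
                       (trans (cong (coord A) (sym vertex-g)) (trans (same-twist v) (cong (coord B) vertex-h))))
      (trans vertex-g (sym vertex-h))
      where
      A B : Fin nF
      A = proj₁ (proj₁ g (ref v , v))
      B = proj₁ (proj₁ h (ref v , v))
      vertex-g : proj₂ (proj₁ g (ref v , v)) ≡ v
      vertex-g = trans (vertex-action legal-g (ref∋ v)) (fixes-vertices legal-g fixed-g v)
      vertex-h : proj₂ (proj₁ h (ref v , v)) ≡ v
      vertex-h = trans (vertex-action legal-h (ref∋ v)) (fixes-vertices legal-h fixed-h v)

    corners-determined : (∀ v → twist g v ≡ twist h v) → ∀ {c} → IsCorner c → proj₁ g c ≡ proj₁ h c
    corners-determined same-twist {H , w} H∋w = begin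
      proj₁ g (H , w)                               ≡⟨ rotational-at (rotational legal-g) H∋w ⟩
      turnsC (coord H w) (proj₁ g (ref w , w))      ≡⟨ cong (turnsC (coord H w)) (ref-corner-determined same-twist w) ⟩
      turnsC (coord H w) (proj₁ h (ref w , w))      ≡⟨ rotational-at (rotational legal-h) H∋w ⟨
      proj₁ h (H , w)                               ∎
      where open ≡-Reasoning

  part-iii : Part-iii M
  part-iii = φ , well-defined , homomorphic , injective
    where
    φ : Elt M → Fin (nV ∸ 1) → Fin 3
    φ g k = twist g (embed k)
    well-defined : ∀ g h → InH₃ M g → InH₃ M h → _≈C_ M g h → ∀ k → φ g k ≡ φ h k
    well-defined g h _ _ g≈h k = cong coordC (same-corner (ref∋ (embed k)))
      where
      same-corner : ∀ {c} → IsCorner c → proj₁ g c ≡ proj₁ h c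
      same-corner {H , _} (i , refl) = g≈h H i
    homomorphic : ∀ g h → InH₃ M g → InH₃ M h → ∀ k → φ (_·_ M g h) k ≡ (φ g k +₃ φ h k)
    homomorphic g h (in-g , _) (in-h , fixed-h) k = trans (twist-∙ legal-g legal-h v)
      (cong (λ u → twist g u +₃ twist h v) (fixes-vertices legal-h fixed-h v))
      where
      v : Fin nV
      v = embed k
      legal-g : Legal g
      legal-g = Legal-rubik in-g
      legal-h : Legal h
      legal-h = Legal-rubik in-h
    injective : ∀ g h → InH₃ M g → InH₃ M h → (∀ k → φ g k ≡ φ h k) → _≈C_ M g h
    injective g h (in-g , fixed-g) (in-h , fixed-h) same F i =
      corners-determined legal-g legal-h fixed-g fixed-h all-twists (i , refl)
      where
      legal-g : Legal g
      legal-g = Legal-rubik in-g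
      legal-h : Legal h
      legal-h = Legal-rubik in-h
      all-twists : ∀ v → twist g v ≡ twist h v
      all-twists = init-determines 2 toℕ toℕ<n toℕ-injective nV (twist g) (twist h)
                     (trans (twists-zero legal-g) (sym (twists-zero legal-h))) same

theorem3 : (M : Map3) → IsOriented3ValentMap M →
    Part-i M × Part-ii M × Part-iii M × Part-iv M
theorem3 M Hy = part-i , part-ii , part-iii , part-iv
  where open Kernels M Hy
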